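{- For all $k\ge 1$, $n\ge 1$ and $j\ge 0$, $$a^{(k)}_{n,231,j}=\sum_{i=0}^{j}a^{(k-1)}_{j,231,i}\binom{n+i}{2j},$$ where $a^{(k-1)}_{0,231,0}:=1$.
   Context: For $n\ge 1$ and $j,k\ge 0$, $a^{(k)}_{n,231,j}$ denotes the number of permutations $\sigma=\sigma_1\cdots\sigma_n$ of $[n]$ that avoid $231$ (no indices $a<b<c$ with $\sigma_c<\sigma_a<\sigma_b$), have exactly $j$ descents (indices $i\in[n-1]$ with $\sigma_i>\sigma_{i+1}$), and satisfy $\max\{i-\sigma_i: i\in[n]\}\le k$. -}

module Defs where

open import Data.Bool using (Bool; true; false; _∧_; _∨_; not)
open import Data.Nat using (ℕ; zero; suc; _+_; _∸_; _<ᵇ_; _≤ᵇ_; _≡ᵇ_)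
open import Data.List using (List; []; _∷_; map; concatMap; applyUpTo; length; filterᵇ)
open import Data.Bool.ListAction using (any)

-- A permutation of [n] is represented by its one-line notation σ₁ ⋯ σₙ,
-- as a list of naturals (values 1..n, positions 1..n).

words : ℕ → ℕ → List (List ℕ)
words n zero    = [] ∷ []
words n (suc m) = concatMap (λ x → map (x ∷_) (words n m)) (applyUpTo suc n)

distinct : List ℕ → Bool
distinct []       = true
distinct (x ∷ xs) = not (any (λ y → x ≡ᵇ y) xs) ∧ distinct xs

perms : ℕ → List (List ℕ)
perms n = filterᵇ distinct (words n n)

has21below : ℕ → List ℕ → Bool
has21below x []       = false
has21below x (y ∷ ys) = ((x <ᵇ y) ∧ any (λ z → z <ᵇ x) ys) ∨ has21below x ys

contains231 : List ℕ → Bool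
contains231 []       = false
contains231 (x ∷ xs) = has21below x xs ∨ contains231 xs

des : List ℕ → ℕ
des []           = 0
des (x ∷ [])     = 0
des (x ∷ y ∷ ys) = (if' (y <ᵇ x)) + des (y ∷ ys)
  where
  if' : Bool → ℕ
  if' true  = 1
  if' false = 0

-- i - σ_i ≤ k for every position i (positions start at i₀); since k ≥ 0,
-- truncated subtraction gives the same condition as integer subtraction.
dispOK : ℕ → ℕ → List ℕ → Bool
dispOK k i []       = true
dispOK k i (x ∷ xs) = ((i ∸ x) ≤ᵇ k) ∧ dispOK k (suc i) xs

-- max{ i - σ_i } ≤ k  (for n ≥ 1); positions are 1-based
maxDispLe : ℕ → List ℕ → Bool
maxDispLe k σ = dispOK k 1 σ

a : ℕ → ℕ → ℕ → ℕ
a k n j = length (filterᵇ (λ σ → not (contains231 σ) ∧ ((des σ ≡ᵇ j) ∧ maxDispLe k σ)) (perms n))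

a' : ℕ → ℕ → ℕ → ℕ
a' k zero zero    = 1
a' k zero (suc j) = 0
a' k (suc n) j    = a k (suc n) j

module Submission where

-- Splitting a 231-avoiding permutation of [n+1] at its first entry v+1 writes it as v+1, α, γ,
-- where α is a 231-avoiding permutation of [v] and γ one of [n-v] shifted up by v+1. Descents add
-- up (plus one at the start when α is nonempty), α is displaced by at most k-1 relative to its own
-- positions and γ by at most k. Hence a k satisfies a recurrence F(n+1, j) = ∑ lead·F(n-v, j-j₁)
-- whose kernel is a (k-1) (for k = 0, the family of the empty permutation), and such a recurrence
-- has a unique solution.
-- The algebraic core: if P solves the recurrence with kernel Q and P is the binomial transform
-- ∑_{i ≤ j} Q(j,i) C(n+i, 2j) of Q, then the transform of P solves the recurrence with kernel P
-- (Pascal's rule, the hockey-stick and Vandermonde identities). Induction on k gives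
-- a k = transform (kernel k), which is the statement.

open import Data.Bool using (Bool; true; false; T; not; _∧_; _∨_)
open import Data.Bool.ListAction using (any)
open import Data.Bool.Properties using (∧-assoc; ∧-identityʳ; ∧-zeroʳ; ∨-assoc; ∨-identityʳ; T-∧; T-≡; T-not-≡)
open import Data.Empty using (⊥-elim)
open import Data.List using (List; []; _∷_; map; length; _++_; filter; filterᵇ; concatMap; cartesianProduct; applyUpTo; upTo)
open import Data.List.Membership.Propositional using (_∈_; _∉_; find; lose)
open import Data.List.Membership.Propositional.Properties
  using (∈-map⁺; ∈-map⁻; ∈-++⁺ˡ; ∈-++⁺ʳ; ∈-++⁻; ∈-filter⁺; ∈-filter⁻; ∈-concatMap⁺; ∈-concatMap⁻;
         ∈-applyUpTo⁺; ∈-applyUpTo⁻; ∈-upTo⁺; ∈-upTo⁻; ∈-cartesianProduct⁺; ∈-cartesianProduct⁻)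
open import Data.List.Membership.Propositional.Properties.WithK using (unique∧set⇒bag)
open import Data.List.Properties
  using (length-map; length-++; length-applyUpTo; length-filter; filter-++; filter-none; filter-complete;
         ∷-injective; ∷-injectiveʳ; map-injective; map-∘; map-id-local)
open import Data.List.Relation.Binary.BagAndSetEquality using (∼bag⇒↭)
open import Data.List.Relation.Binary.Disjoint.Propositional using (Disjoint)
open import Data.List.Relation.Binary.Permutation.Propositional using (_↭_)
open import Data.List.Relation.Binary.Permutation.Propositional.Properties using (↭-length; filter-↭)
open import Data.List.Relation.Unary.All using ([]; _∷_)
import Data.List.Relation.Unary.All as All
import Data.List.Relation.Unary.All.Properties as All
open import Data.List.Relation.Unary.All.Properties using (¬Any⇒All¬; All¬⇒¬Any)
import Data.List.Relation.Unary.AllPairs as AllPairs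
import Data.List.Relation.Unary.AllPairs.Properties as AllPairs
open import Data.List.Relation.Unary.Any using (here; there)
import Data.List.Relation.Unary.Any as Any
open import Data.List.Relation.Unary.Any.Properties using (any⁺; any⁻)
open import Data.List.Relation.Unary.Unique.Propositional using (Unique; []; _∷_)
import Data.List.Relation.Unary.Unique.Propositional.Properties as UP
open UP using (Unique[x∷xs]⇒x∉xs)
open import Data.Nat
open import Data.Nat.Combinatorics using (_C_; nCk≡nC[n∸k]; nCn≡1; nCk+nC[k+1]≡[n+1]C[k+1]; k>n⇒nCk≡0)
open import Data.Nat.ListAction using (sum)
open import Data.Nat.Properties
open import Algebra.Properties.CommutativeSemigroup +-commutativeSemigroup
  using () renaming (interchange to +-interchange)
open import Algebra.Properties.CommutativeSemigroup *-commutativeSemigroup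
  using () renaming (interchange to *-interchange)
open import Data.Nat.Tactic.RingSolver using (solve-∀)
open import Data.Product using (_×_; _,_; proj₁; proj₂; ∃; ∃₂)
open import Data.Sum using (inj₁; inj₂)
open import Function using (_∘_; _⇔_; mk⇔; Equivalence)
open import Relation.Binary.Definitions using (DecidableEquality; tri<; tri≈; tri>)
open import Relation.Binary.PropositionalEquality
open import Relation.Nullary using (¬_; contradiction)
open import Relation.Nullary.Decidable using (T?)
open import Defs

∑ : ℕ → (ℕ → ℕ) → ℕ
∑ zero    f = 0
∑ (suc n) f = f 0 + ∑ n (f ∘ suc)

syntax ∑ n (λ i → e) = ∑[ i < n ] e

∑-upTo : ∀ n (f : ℕ → ℕ) → sum (map f (upTo n)) ≡ ∑ n f
∑-upTo n = go n (λ i → i)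
  where
  go : ∀ n (g f : ℕ → ℕ) → sum (map f (applyUpTo g n)) ≡ ∑ n (f ∘ g)
  go zero    g f = refl
  go (suc n) g f = cong (f (g 0) +_) (go n (g ∘ suc) f)

∑-cong : ∀ n {f g : ℕ → ℕ} → (∀ i → i < n → f i ≡ g i) → ∑ n f ≡ ∑ n g
∑-cong zero    eq = refl
∑-cong (suc n) eq = cong₂ _+_ (eq 0 z<s) (∑-cong n (λ i i<n → eq (suc i) (s<s i<n)))

∑-ext : ∀ n {f g : ℕ → ℕ} → (∀ i → f i ≡ g i) → ∑ n f ≡ ∑ n g
∑-ext n eq = ∑-cong n (λ i _ → eq i)

∑-zero : ∀ n {f : ℕ → ℕ} → (∀ i → i < n → f i ≡ 0) → ∑ n f ≡ 0
∑-zero n eq = trans (∑-cong n eq) (∑-const0 n)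
  where
  ∑-const0 : ∀ n → ∑[ i < n ] 0 ≡ 0
  ∑-const0 zero    = refl
  ∑-const0 (suc n) = ∑-const0 n

∑-last : ∀ n f → ∑ (suc n) f ≡ ∑ n f + f n
∑-last zero    f = +-comm (f 0) 0
∑-last (suc n) f = trans (cong (f 0 +_) (∑-last n (f ∘ suc))) (sym (+-assoc (f 0) _ _))

∑-split : ∀ a b f → ∑ (a + b) f ≡ ∑ a f + ∑[ i < b ] f (a + i)
∑-split zero    b f = refl
∑-split (suc a) b f = trans (cong (f 0 +_) (∑-split a b (f ∘ suc))) (sym (+-assoc (f 0) _ _))

∑-extend : ∀ {m n} f → m ≤ n → (∀ i → m ≤ i → i < n → f i ≡ 0) → ∑ m f ≡ ∑ n f
∑-extend {m} {n} f m≤n vanish = begin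
  ∑ m f                                 ≡⟨ +-identityʳ (∑ m f) ⟨
  ∑ m f + 0                             ≡⟨ cong (∑ m f +_) (∑-zero (n ∸ m) tail≡0) ⟨
  ∑ m f + ∑[ i < n ∸ m ] f (m + i)      ≡⟨ ∑-split m (n ∸ m) f ⟨
  ∑ (m + (n ∸ m)) f                     ≡⟨ cong (λ x → ∑ x f) (m+[n∸m]≡n m≤n) ⟩
  ∑ n f                                 ∎
  where
  open ≡-Reasoning
  tail≡0 : ∀ i → i < n ∸ m → f (m + i) ≡ 0
  tail≡0 i i< = vanish (m + i) (m≤m+n m i)
    (subst (m + i <_) (m+[n∸m]≡n m≤n) (+-monoʳ-< m i<))

∑-window : ∀ s n t f → (∀ a → a < s → f a ≡ 0) → (∀ y → y < t → f (s + (n + y)) ≡ 0) →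
  ∑ (s + (n + t)) f ≡ ∑[ m < n ] f (s + m)
∑-window s n t f head≡0 tail≡0 = begin
  ∑ (s + (n + t)) f                                               ≡⟨ ∑-split s (n + t) f ⟩
  ∑ s f + ∑[ i < n + t ] f (s + i)                                ≡⟨ cong (_+ ∑[ i < n + t ] f (s + i)) (∑-zero s head≡0) ⟩
  ∑[ i < n + t ] f (s + i)                                        ≡⟨ ∑-split n t (λ i → f (s + i)) ⟩
  ∑[ m < n ] f (s + m) + ∑[ y < t ] f (s + (n + y))               ≡⟨ cong (∑[ m < n ] f (s + m) +_) (∑-zero t tail≡0) ⟩
  ∑[ m < n ] f (s + m) + 0                                        ≡⟨ +-identityʳ _ ⟩
  ∑[ m < n ] f (s + m)                                            ∎
  where open ≡-Reasoning

∑-+ : ∀ n f g → ∑[ i < n ] (f i + g i) ≡ ∑ n f + ∑ n g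
∑-+ zero    f g = refl
∑-+ (suc n) f g = trans (cong (f 0 + g 0 +_) (∑-+ n (f ∘ suc) (g ∘ suc)))
                        (+-interchange (f 0) (g 0) (∑ n (f ∘ suc)) (∑ n (g ∘ suc)))

∑-*ˡ : ∀ n c f → ∑[ i < n ] (c * f i) ≡ c * ∑ n f
∑-*ˡ zero    c f = sym (*-zeroʳ c)
∑-*ˡ (suc n) c f = trans (cong (c * f 0 +_) (∑-*ˡ n c (f ∘ suc))) (sym (*-distribˡ-+ c (f 0) _))

∑-*ʳ : ∀ n c f → ∑[ i < n ] (f i * c) ≡ ∑ n f * c
∑-*ʳ n c f = trans (∑-ext n (λ i → *-comm (f i) c)) (trans (∑-*ˡ n c f) (*-comm c (∑ n f)))

∑-product : ∀ a b f g → ∑ a f * ∑ b g ≡ ∑[ i < a ] ∑[ l < b ] (f i * g l)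
∑-product a b f g = trans (sym (∑-*ʳ a (∑ b g) f)) (∑-ext a (λ i → sym (∑-*ˡ b (f i) g)))

∑-swap : ∀ n m (f : ℕ → ℕ → ℕ) → ∑[ i < n ] ∑[ l < m ] f i l ≡ ∑[ l < m ] ∑[ i < n ] f i l
∑-swap zero    m f = sym (∑-zero m (λ _ _ → refl))
∑-swap (suc n) m f = trans (cong (∑ m (f 0) +_) (∑-swap n m (f ∘ suc)))
                           (sym (∑-+ m (f 0) (λ l → ∑[ i < n ] f (suc i) l)))

∑-reverse : ∀ n f → ∑[ i < n ] f (n ∸ suc i) ≡ ∑ n f
∑-reverse zero    f = refl
∑-reverse (suc n) f = begin
  f n + ∑[ i < n ] f (n ∸ suc i) ≡⟨ +-comm (f n) _ ⟩
  ∑[ i < n ] f (n ∸ suc i) + f n ≡⟨ cong (_+ f n) (∑-reverse n f) ⟩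
  ∑ n f + f n                    ≡⟨ ∑-last n f ⟨
  ∑ (suc n) f                    ∎
  where open ≡-Reasoning

∑-triangle : ∀ N (g : ℕ → ℕ → ℕ) →
  ∑[ i < N ] ∑[ l < suc i ] g l (i ∸ l) ≡ ∑[ l < N ] ∑[ i' < N ∸ l ] g l i'
∑-triangle zero    g = refl
∑-triangle (suc N) g = begin
  ∑[ i < suc N ] ∑[ l < suc i ] g l (i ∸ l)
    ≡⟨ ∑-last N _ ⟩
  ∑[ i < N ] ∑[ l < suc i ] g l (i ∸ l) + diagonal
    ≡⟨ cong (_+ diagonal) (∑-triangle N g) ⟩
  ∑[ l < N ] ∑[ i' < N ∸ l ] g l i' + diagonal
    ≡⟨ cong (_+ diagonal) (∑-extend (λ l → ∑[ i' < N ∸ l ] g l i') (n≤1+n N) lastRow≡0) ⟩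
  ∑[ l < suc N ] ∑[ i' < N ∸ l ] g l i' + diagonal
    ≡⟨ ∑-+ (suc N) (λ l → ∑[ i' < N ∸ l ] g l i') (λ l → g l (N ∸ l)) ⟨
  ∑[ l < suc N ] (∑[ i' < N ∸ l ] g l i' + g l (N ∸ l))
    ≡⟨ ∑-cong (suc N) extendRow ⟩
  ∑[ l < suc N ] ∑[ i' < suc N ∸ l ] g l i' ∎
  where
  open ≡-Reasoning
  diagonal : ℕ
  diagonal = ∑[ l < suc N ] g l (N ∸ l)
  lastRow≡0 : ∀ l → N ≤ l → l < suc N → ∑[ i' < N ∸ l ] g l i' ≡ 0
  lastRow≡0 l N≤l _ = cong (λ x → ∑ x (g l)) (m≤n⇒m∸n≡0 N≤l)
  extendRow : ∀ l → l < suc N → ∑[ i' < N ∸ l ] g l i' + g l (N ∸ l) ≡ ∑[ i' < suc N ∸ l ] g l i'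
  extendRow l l< = trans (sym (∑-last (N ∸ l) (g l)))
                         (cong (λ x → ∑ x (g l)) (sym (+-∸-assoc 1 (≤-pred l<))))

n≤2*n : ∀ n → n ≤ 2 * n
n≤2*n n = m≤m+n n (n + 0)

nC0≡1 : ∀ n → n C 0 ≡ 1
nC0≡1 n = trans (nCk≡nC[n∸k] {0} {n} z≤n) (nCn≡1 n)

hockey-stick : ∀ n i r → ∑[ m < n ] ((m + i) C r) + i C suc r ≡ (n + i) C suc r
hockey-stick zero    i r = refl
hockey-stick (suc n) i r = begin
  ∑[ m < suc n ] ((m + i) C r) + i C suc r    ≡⟨ cong (_+ i C suc r) (∑-last n (λ m → (m + i) C r)) ⟩
  ∑[ m < n ] ((m + i) C r) + (n + i) C r + i C suc r
    ≡⟨ +-assoc (∑[ m < n ] ((m + i) C r)) _ _ ⟩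
  ∑[ m < n ] ((m + i) C r) + ((n + i) C r + i C suc r)
    ≡⟨ cong (∑[ m < n ] ((m + i) C r) +_) (+-comm ((n + i) C r) _) ⟩
  ∑[ m < n ] ((m + i) C r) + (i C suc r + (n + i) C r)
    ≡⟨ +-assoc (∑[ m < n ] ((m + i) C r)) _ _ ⟨
  ∑[ m < n ] ((m + i) C r) + i C suc r + (n + i) C r
    ≡⟨ cong (_+ (n + i) C r) (hockey-stick n i r) ⟩
  (n + i) C suc r + (n + i) C r               ≡⟨ +-comm ((n + i) C suc r) _ ⟩
  (n + i) C r + (n + i) C suc r               ≡⟨ nCk+nC[k+1]≡[n+1]C[k+1] (n + i) r ⟩
  suc (n + i) C suc r                         ∎
  where open ≡-Reasoning

vandermonde : ∀ N p q → ∑[ a < suc N ] ((a C p) * ((N ∸ a) C q)) ≡ suc N C suc (p + q)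
vandermonde N p zero = begin
  ∑[ a < suc N ] ((a C p) * ((N ∸ a) C 0)) ≡⟨ ∑-ext (suc N) dropSecondFactor ⟩
  ∑[ a < suc N ] ((a + 0) C p)             ≡⟨ +-identityʳ _ ⟨
  ∑[ a < suc N ] ((a + 0) C p) + 0         ≡⟨ cong (∑[ a < suc N ] ((a + 0) C p) +_) (k>n⇒nCk≡0 {0} {suc p} z<s) ⟨
  ∑[ a < suc N ] ((a + 0) C p) + 0 C suc p ≡⟨ hockey-stick (suc N) 0 p ⟩
  (suc N + 0) C suc p                      ≡⟨ cong₂ (λ x y → x C suc y) (+-identityʳ (suc N)) (sym (+-identityʳ p)) ⟩
  suc N C suc (p + 0)                      ∎
  where
  open ≡-Reasoning
  dropSecondFactor : ∀ a → (a C p) * ((N ∸ a) C 0) ≡ (a + 0) C p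
  dropSecondFactor a = begin
    (a C p) * ((N ∸ a) C 0) ≡⟨ cong ((a C p) *_) (nC0≡1 (N ∸ a)) ⟩
    (a C p) * 1             ≡⟨ *-identityʳ (a C p) ⟩
    a C p                   ≡⟨ cong (_C p) (+-identityʳ a) ⟨
    (a + 0) C p             ∎
vandermonde zero p (suc q) = begin
  (0 C p) * 0 + 0                          ≡⟨ cong (_+ 0) (*-zeroʳ (0 C p)) ⟩
  0                                        ≡⟨ k>n⇒nCk≡0 1<k ⟨
  1 C suc (p + suc q)                      ∎
  where
  open ≡-Reasoning
  1<k : 1 < suc (p + suc q)
  1<k = s≤s (≤-trans (s≤s z≤n) (m≤n+m (suc q) p))
vandermonde (suc N) p (suc q) = begin
  ∑[ a < suc (suc N) ] term (suc N) (suc q) a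
    ≡⟨ ∑-extend (term (suc N) (suc q)) (n≤1+n (suc N)) lastTerm≡0 ⟨
  ∑[ a < suc N ] term (suc N) (suc q) a
    ≡⟨ ∑-cong (suc N) pascal ⟩
  ∑[ a < suc N ] (term N q a + term N (suc q) a)
    ≡⟨ ∑-+ (suc N) (term N q) (term N (suc q)) ⟩
  ∑[ a < suc N ] term N q a + ∑[ a < suc N ] term N (suc q) a
    ≡⟨ cong₂ _+_ (vandermonde N p q) (vandermonde N p (suc q)) ⟩
  suc N C suc (p + q) + suc N C suc (p + suc q)
    ≡⟨ cong (λ x → suc N C suc (p + q) + suc N C suc x) (+-suc p q) ⟩
  suc N C suc (p + q) + suc N C suc (suc (p + q))
    ≡⟨ nCk+nC[k+1]≡[n+1]C[k+1] (suc N) (suc (p + q)) ⟩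
  suc (suc N) C suc (suc (p + q))          ≡⟨ cong (λ x → suc (suc N) C suc x) (+-suc p q) ⟨
  suc (suc N) C suc (p + suc q)            ∎
  where
  open ≡-Reasoning
  term : ℕ → ℕ → ℕ → ℕ
  term M s a = (a C p) * ((M ∸ a) C s)
  lastTerm≡0 : ∀ a → suc N ≤ a → a < suc (suc N) → term (suc N) (suc q) a ≡ 0
  lastTerm≡0 a N<a _ = begin
    (a C p) * ((suc N ∸ a) C suc q) ≡⟨ cong (λ x → (a C p) * (x C suc q)) (m≤n⇒m∸n≡0 N<a) ⟩
    (a C p) * (0 C suc q)           ≡⟨ cong ((a C p) *_) (k>n⇒nCk≡0 {0} {suc q} z<s) ⟩
    (a C p) * 0                     ≡⟨ *-zeroʳ (a C p) ⟩
    0                               ∎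
  pascal : ∀ a → a < suc N → term (suc N) (suc q) a ≡ term N q a + term N (suc q) a
  pascal a a≤N = begin
    (a C p) * ((suc N ∸ a) C suc q)               ≡⟨ cong (λ x → (a C p) * (x C suc q)) (+-∸-assoc 1 (≤-pred a≤N)) ⟩
    (a C p) * (suc (N ∸ a) C suc q)               ≡⟨ cong ((a C p) *_) (nCk+nC[k+1]≡[n+1]C[k+1] (N ∸ a) q) ⟨
    (a C p) * ((N ∸ a) C q + (N ∸ a) C suc q)     ≡⟨ *-distribˡ-+ (a C p) _ _ ⟩
    term N q a + term N (suc q) a                 ∎

-- Past the window, the second binomial of vandermonde-window has a too small upper index.
beyondWindow : ∀ l n i y → y < i → (l + (n + i)) ∸ (suc l + (n + y)) < i
beyondWindow l n i y y<i = begin-strict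
  (l + (n + i)) ∸ (suc l + (n + y))   ≡⟨ cong ((l + (n + i)) ∸_) (+-suc l (n + y)) ⟨
  (l + (n + i)) ∸ (l + suc (n + y))   ≡⟨ [m+n]∸[m+o]≡n∸o l (n + i) (suc (n + y)) ⟩
  (n + i) ∸ suc (n + y)               ≡⟨ cong ((n + i) ∸_) (+-suc n y) ⟨
  (n + i) ∸ (n + suc y)               ≡⟨ [m+n]∸[m+o]≡n∸o n i (suc y) ⟩
  i ∸ suc y                           <⟨ ∸-monoʳ-< {i} {suc y} {0} z<s y<i ⟩
  i                                   ∎
  where open ≤-Reasoning

-- Vandermonde's identity restricted to the window where neither factor is forced to vanish:
-- for l < p and i ≤ q, ∑_{m<n} C(m+1+l, p) C(n-m-1+i, q) = C(n+l+i+1, p+q+1).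
vandermonde-window : ∀ n l i p q → l < p → i ≤ q →
  ∑[ m < n ] (((suc m + l) C p) * (((n ∸ suc m) + i) C q)) ≡ (n + suc (l + i)) C suc (p + q)
vandermonde-window n l i p q l<p i≤q = begin
  ∑[ m < n ] (((suc m + l) C p) * (((n ∸ suc m) + i) C q)) ≡⟨ ∑-cong n (λ m m<n → sym (inWindow m m<n)) ⟩
  ∑[ m < n ] term (suc l + m)                          ≡⟨ ∑-window (suc l) n i term before after ⟨
  ∑[ a < suc N ] term a                                ≡⟨ vandermonde N p q ⟩
  suc N C suc (p + q)                                  ≡⟨ cong (_C suc (p + q)) (rearrange l n i) ⟩
  (n + suc (l + i)) C suc (p + q)                      ∎
  where
  open ≡-Reasoning
  N : ℕ
  N = l + (n + i)
  term : ℕ → ℕ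
  term a = (a C p) * ((N ∸ a) C q)
  rearrange : ∀ l n i → suc (l + (n + i)) ≡ n + suc (l + i)
  rearrange = solve-∀
  before : ∀ a → a < suc l → term a ≡ 0
  before a a≤l = cong (_* ((N ∸ a) C q)) (k>n⇒nCk≡0 (<-≤-trans a≤l l<p))
  after : ∀ y → y < i → term (suc l + (n + y)) ≡ 0
  after y y<i = trans (cong (((suc l + (n + y)) C p) *_) (k>n⇒nCk≡0 (<-≤-trans (beyondWindow l n i y y<i) i≤q)))
                      (*-zeroʳ ((suc l + (n + y)) C p))
  inWindow : ∀ m → m < n → term (suc l + m) ≡ ((suc m + l) C p) * (((n ∸ suc m) + i) C q)
  inWindow m m<n = cong₂ (λ x y → (x C p) * (y C q)) (cong suc (+-comm l m)) shift
    where
    shift : N ∸ (suc l + m) ≡ (n ∸ suc m) + i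
    shift = begin
      N ∸ (suc l + m)             ≡⟨ cong (N ∸_) (+-suc l m) ⟨
      (l + (n + i)) ∸ (l + suc m) ≡⟨ [m+n]∸[m+o]≡n∸o l (n + i) (suc m) ⟩
      (n + i) ∸ suc m             ≡⟨ +-∸-comm i m<n ⟩
      (n ∸ suc m) + i             ∎

-- Arrays F n j of numbers, indexed by a size n and the value j of a statistic.
Family : Set
Family = ℕ → ℕ → ℕ

δ₀ : ℕ → ℕ
δ₀ zero    = 1
δ₀ (suc _) = 0

Triangular : Family → Set
Triangular F = ∀ {n j} → n < j → F n j ≡ 0

-- Weight of a leading block of size v with statistic value j in the recurrence with kernel Q:
-- the empty block has weight δ₀ j; a nonempty block contributes one more than its kernel value.
lead : Family → Family
lead Q zero    j       = δ₀ j
lead Q (suc v) zero    = 0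
lead Q (suc v) (suc j) = Q (suc v) j

stepSum : Family → Family → ℕ → ℕ → ℕ
stepSum Q F n j = ∑[ v < suc n ] ∑[ j₁ < suc j ] (lead Q v j₁ * F (n ∸ v) (j ∸ j₁))

-- The part of stepSum coming from nonempty leading blocks (v = m + 1, j₁ = u + 1).
stepTail : Family → Family → ℕ → ℕ → ℕ
stepTail Q F n j = ∑[ m < n ] ∑[ u < j ] (Q (suc m) u * F (n ∸ suc m) (j ∸ suc u))

step-split : ∀ Q F n j → stepSum Q F n j ≡ F n j + stepTail Q F n j
step-split Q F n j = cong (_+ stepTail Q F n j) emptyBlock
  where
  emptyBlock : F n j + 0 + ∑[ j₁ < j ] 0 ≡ F n j
  emptyBlock = trans (cong (F n j + 0 +_) (∑-zero j (λ _ _ → refl))) (trans (+-identityʳ _) (+-identityʳ _))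

record Solves (Q F : Family) : Set where
  field
    initial : ∀ j → F 0 j ≡ δ₀ j
    step    : ∀ n j → F (suc n) j ≡ stepSum Q F n j

stepSum-cong : ∀ Q {F G} n j → (∀ m → m ≤ n → ∀ j → F m j ≡ G m j) → stepSum Q F n j ≡ stepSum Q G n j
stepSum-cong Q n j eq = ∑-cong (suc n) (λ v v≤n →
  ∑-ext (suc j) (λ j₁ → cong (lead Q v j₁ *_) (eq (n ∸ v) (m∸n≤m n v) (j ∸ j₁))))

solution-unique : ∀ {Q F G} → Solves Q F → Solves Q G → ∀ n j → F n j ≡ G n j
solution-unique {Q} {F} {G} F-solves G-solves n = upToBound n n ≤-refl
  where
  open Solves
  upToBound : ∀ bound n → n ≤ bound → ∀ j → F n j ≡ G n j
  upToBound _ zero _ j = trans (initial F-solves j) (sym (initial G-solves j))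
  upToBound (suc bound) (suc n) (s≤s n≤bound) j = begin
    F (suc n) j     ≡⟨ step F-solves n j ⟩
    stepSum Q F n j ≡⟨ stepSum-cong Q n j (λ m m≤n → upToBound bound m (≤-trans m≤n n≤bound)) ⟩
    stepSum Q G n j ≡⟨ step G-solves n j ⟨
    G (suc n) j     ∎
    where open ≡-Reasoning

transform : Family → Family
transform Q n j = ∑[ i < suc j ] (Q j i * ((n + i) C (2 * j)))

-- C(n + i, 2j) vanishes when n < j and i ≤ j, so every transform is triangular.
transform-triangular : ∀ Q → Triangular (transform Q)
transform-triangular Q {n} {j} n<j = ∑-zero (suc j) (λ i i≤j →
  trans (cong (Q j i *_) (k>n⇒nCk≡0 (small (≤-pred i≤j)))) (*-zeroʳ (Q j i)))
  where
  small : ∀ {i} → i ≤ j → n + i < 2 * j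
  small {i} i≤j = subst (n + i <_) (cong (j +_) (sym (+-identityʳ j))) (+-mono-<-≤ n<j i≤j)

transform-pascal : ∀ F n J →
  transform F (suc n) (suc J) ≡ ∑[ i < suc (suc J) ] (F (suc J) i * ((n + i) C suc (2 * J))) + transform F n (suc J)
transform-pascal F n J = trans (∑-ext (suc (suc J)) pascal)
  (∑-+ (suc (suc J)) (λ i → F (suc J) i * ((n + i) C suc (2 * J))) (λ i → F (suc J) i * ((n + i) C (2 * suc J))))
  where
  pascal : ∀ i → F (suc J) i * ((suc n + i) C (2 * suc J)) ≡
                 F (suc J) i * ((n + i) C suc (2 * J)) + F (suc J) i * ((n + i) C (2 * suc J))
  pascal i = begin
    F (suc J) i * ((suc n + i) C (2 * suc J))
      ≡⟨ cong (λ x → F (suc J) i * ((suc n + i) C x)) (*-suc 2 J) ⟩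
    F (suc J) i * (suc (n + i) C suc (suc (2 * J)))
      ≡⟨ cong (F (suc J) i *_) (nCk+nC[k+1]≡[n+1]C[k+1] (n + i) (suc (2 * J))) ⟨
    F (suc J) i * ((n + i) C suc (2 * J) + (n + i) C suc (suc (2 * J)))
      ≡⟨ *-distribˡ-+ (F (suc J) i) _ _ ⟩
    F (suc J) i * ((n + i) C suc (2 * J)) + F (suc J) i * ((n + i) C suc (suc (2 * J)))
      ≡⟨ cong (λ x → F (suc J) i * ((n + i) C suc (2 * J)) + F (suc J) i * ((n + i) C x)) (*-suc 2 J) ⟨
    F (suc J) i * ((n + i) C suc (2 * J)) + F (suc J) i * ((n + i) C (2 * suc J)) ∎
    where open ≡-Reasoning

module TransformRecurrence
  {Q P : Family} (Q-triangular : Triangular Q) (Q₀₀ : Q 0 0 ≡ 1)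
  (P-solves : Solves Q P) (P≡transform : ∀ n j → P n j ≡ transform Q n j) where

  open Solves P-solves renaming (initial to P-initial; step to P-step)

  TP : Family
  TP = transform P

  P-triangular : Triangular P
  P-triangular n<j = trans (P≡transform _ _) (transform-triangular Q n<j)

  P-column₀ : ∀ m → P (suc m) 0 ≡ 1
  P-column₀ m = begin
    P (suc m) 0                        ≡⟨ P≡transform (suc m) 0 ⟩
    Q 0 0 * ((suc m + 0) C 0) + 0      ≡⟨ +-identityʳ _ ⟩
    Q 0 0 * ((suc m + 0) C 0)          ≡⟨ cong₂ _*_ Q₀₀ (nC0≡1 (suc m + 0)) ⟩
    1                                  ∎
    where open ≡-Reasoning

  -- At size 0 only i ≤ j with C(i, 2j) ≠ 0 survive, i.e. j = 0.
  TP-initial : ∀ j → TP 0 j ≡ δ₀ j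
  TP-initial zero    = trans (+-identityʳ _) (trans (*-identityʳ (P 0 0)) (P-initial 0))
  TP-initial (suc J) = ∑-zero (suc (suc J)) (λ i i≤J+1 →
    trans (cong (P (suc J) i *_) (k>n⇒nCk≡0 (small (≤-pred i≤J+1)))) (*-zeroʳ (P (suc J) i)))
    where
    small : ∀ {i} → i ≤ suc J → i < 2 * suc J
    small {i} i≤J+1 = subst (i <_) (sym (*-suc 2 J)) (s≤s (≤-trans i≤J+1 (s≤s (n≤2*n J))))

  -- Column (n, J): by Pascal's rule, TP (n+1) (J+1) = X + TP n (J+1), and X is the tail of the
  -- recurrence for TP. Both sides split into a part where the leading block has statistic 0
  -- (matched by the hockey-stick identity) and the rest (matched by Vandermonde's identity).
  module Column (n J : ℕ) where

    X : ℕ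
    X = ∑[ i < suc (suc J) ] (P (suc J) i * ((n + i) C suc (2 * J)))

    X₀ X₁ : ℕ
    X₀ = ∑[ i < suc (suc J) ] (P J i * ((n + i) C suc (2 * J)))
    X₁ = ∑[ i < suc (suc J) ] (stepTail Q P J i * ((n + i) C suc (2 * J)))

    X-split : X ≡ X₀ + X₁
    X-split = trans (∑-ext (suc (suc J)) unfold)
      (∑-+ (suc (suc J)) (λ i → P J i * ((n + i) C suc (2 * J))) (λ i → stepTail Q P J i * ((n + i) C suc (2 * J))))
      where
      unfold : ∀ i → P (suc J) i * ((n + i) C suc (2 * J)) ≡
                     P J i * ((n + i) C suc (2 * J)) + stepTail Q P J i * ((n + i) C suc (2 * J))
      unfold i = trans (cong (_* ((n + i) C suc (2 * J))) (trans (P-step J i) (step-split Q P J i)))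
                       (*-distribʳ-+ ((n + i) C suc (2 * J)) (P J i) (stepTail Q P J i))

    Y₀ Y₁ : ℕ
    Y₀ = ∑[ m < n ] (P (suc m) 0 * TP (n ∸ suc m) J)
    Y₁ = ∑[ m < n ] ∑[ u < J ] (P (suc m) (suc u) * TP (n ∸ suc m) (J ∸ suc u))

    tail-split : stepTail P TP n (suc J) ≡ Y₀ + Y₁
    tail-split = ∑-+ n (λ m → P (suc m) 0 * TP (n ∸ suc m) J)
                       (λ m → ∑[ u < J ] (P (suc m) (suc u) * TP (n ∸ suc m) (J ∸ suc u)))

    Y₀≡X₀ : Y₀ ≡ X₀
    Y₀≡X₀ = begin
      Y₀                                                    ≡⟨ ∑-ext n (λ m → trans (cong (_* TP (n ∸ suc m) J) (P-column₀ m)) (+-identityʳ _)) ⟩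
      ∑[ m < n ] TP (n ∸ suc m) J                            ≡⟨ ∑-reverse n (λ m → TP m J) ⟩
      ∑[ m < n ] ∑[ i < suc J ] (P J i * ((m + i) C (2 * J))) ≡⟨ ∑-swap n (suc J) (λ m i → P J i * ((m + i) C (2 * J))) ⟩
      ∑[ i < suc J ] ∑[ m < n ] (P J i * ((m + i) C (2 * J))) ≡⟨ ∑-cong (suc J) hockey ⟩
      ∑[ i < suc J ] (P J i * ((n + i) C suc (2 * J)))      ≡⟨ ∑-extend (λ i → P J i * ((n + i) C suc (2 * J))) (n≤1+n (suc J)) beyondJ ⟩
      X₀                                                    ∎
      where
      open ≡-Reasoning
      hockey : ∀ i → i < suc J → ∑[ m < n ] (P J i * ((m + i) C (2 * J))) ≡ P J i * ((n + i) C suc (2 * J))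
      hockey i i≤J = begin
        ∑[ m < n ] (P J i * ((m + i) C (2 * J)))             ≡⟨ ∑-*ˡ n (P J i) (λ m → (m + i) C (2 * J)) ⟩
        P J i * ∑[ m < n ] ((m + i) C (2 * J))               ≡⟨ cong (P J i *_) (+-identityʳ _) ⟨
        P J i * (∑[ m < n ] ((m + i) C (2 * J)) + 0)         ≡⟨ cong (λ x → P J i * (∑[ m < n ] ((m + i) C (2 * J)) + x)) (k>n⇒nCk≡0 i<2J+1) ⟨
        P J i * (∑[ m < n ] ((m + i) C (2 * J)) + i C suc (2 * J)) ≡⟨ cong (P J i *_) (hockey-stick n i (2 * J)) ⟩
        P J i * ((n + i) C suc (2 * J))                      ∎
        where
        i<2J+1 : i < suc (2 * J)
        i<2J+1 = s≤s (≤-trans (≤-pred i≤J) (n≤2*n J))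
      beyondJ : ∀ i → suc J ≤ i → i < suc (suc J) → P J i * ((n + i) C suc (2 * J)) ≡ 0
      beyondJ i J<i _ = cong (_* ((n + i) C suc (2 * J))) (P-triangular J<i)

    -- Y₁ and X₁ both regroup as ∑_{u<J} block u, where, with B = J - u - 1,
    -- block u = ∑_{l ≤ u+1} ∑_{i ≤ B} Q(u+1, l) · P(B, i) · C(n + l + i + 1, 2J + 1).
    term : ℕ → ℕ → ℕ → ℕ
    term u l i = Q (suc u) l * P (J ∸ suc u) i * ((n + suc (l + i)) C suc (2 * J))

    block : ℕ → ℕ
    block u = ∑[ l < suc (suc u) ] ∑[ i < suc (J ∸ suc u) ] term u l i

    -- In X₁ the index u is the size of the leading block of P (J+1) i.
    Xblock : ℕ → ℕ
    Xblock u = ∑[ i < suc (suc J) ] ∑[ l < i ] (Q (suc u) l * P (J ∸ suc u) (i ∸ suc l) * ((n + i) C suc (2 * J)))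

    X₁-regroup : X₁ ≡ ∑[ u < J ] Xblock u
    X₁-regroup = begin
      X₁
        ≡⟨ ∑-ext (suc (suc J)) distribute ⟩
      ∑[ i < suc (suc J) ] ∑[ u < J ] ∑[ l < i ] (Q (suc u) l * P (J ∸ suc u) (i ∸ suc l) * ((n + i) C suc (2 * J)))
        ≡⟨ ∑-swap (suc (suc J)) J (λ i u → ∑[ l < i ] (Q (suc u) l * P (J ∸ suc u) (i ∸ suc l) * ((n + i) C suc (2 * J)))) ⟩
      ∑[ u < J ] Xblock u ∎
      where
      open ≡-Reasoning
      distribute : ∀ i → stepTail Q P J i * ((n + i) C suc (2 * J)) ≡
        ∑[ u < J ] ∑[ l < i ] (Q (suc u) l * P (J ∸ suc u) (i ∸ suc l) * ((n + i) C suc (2 * J)))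
      distribute i = trans (sym (∑-*ʳ J ((n + i) C suc (2 * J)) (λ u → ∑[ l < i ] (Q (suc u) l * P (J ∸ suc u) (i ∸ suc l)))))
                           (∑-ext J (λ u → sym (∑-*ʳ i ((n + i) C suc (2 * J)) (λ l → Q (suc u) l * P (J ∸ suc u) (i ∸ suc l)))))

    -- Reindexing the triangle {l < i ≤ J+1} by (l, i - l - 1) and using that Q and P are triangular.
    Xblock≡block : ∀ u → u < J → Xblock u ≡ block u
    Xblock≡block u u<J = begin
      Xblock u
        ≡⟨ ∑-cong (suc J) (λ i i≤J → ∑-cong (suc i) (λ l l≤i →
             cong (λ x → Q (suc u) l * P (J ∸ suc u) (i ∸ l) * ((n + suc x) C suc (2 * J))) (sym (m+[n∸m]≡n (≤-pred l≤i))))) ⟩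
      ∑[ i < suc J ] ∑[ l < suc i ] term u l (i ∸ l)
        ≡⟨ ∑-triangle (suc J) (term u) ⟩
      ∑[ l < suc J ] ∑[ i < suc J ∸ l ] term u l i
        ≡⟨ ∑-extend (λ l → ∑[ i < suc J ∸ l ] term u l i) (s≤s u<J) Q-vanishes ⟨
      ∑[ l < suc (suc u) ] ∑[ i < suc J ∸ l ] term u l i
        ≡⟨ ∑-cong (suc (suc u)) (λ l l≤u+1 → sym (∑-extend (term u l) (rowLength (≤-pred l≤u+1)) (P-vanishes l))) ⟩
      block u ∎
      where
      open ≡-Reasoning
      Q-vanishes : ∀ l → suc (suc u) ≤ l → l < suc J → ∑[ i < suc J ∸ l ] term u l i ≡ 0
      Q-vanishes l u+1<l _ = ∑-zero (suc J ∸ l) (λ i _ →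
        cong (λ x → x * P (J ∸ suc u) i * ((n + suc (l + i)) C suc (2 * J))) (Q-triangular u+1<l))
      P-vanishes : ∀ l i → suc (J ∸ suc u) ≤ i → i < suc J ∸ l → term u l i ≡ 0
      P-vanishes l i B<i _ = begin
        Q (suc u) l * P (J ∸ suc u) i * ((n + suc (l + i)) C suc (2 * J))
          ≡⟨ cong (λ x → Q (suc u) l * x * ((n + suc (l + i)) C suc (2 * J))) (P-triangular B<i) ⟩
        Q (suc u) l * 0 * ((n + suc (l + i)) C suc (2 * J))
          ≡⟨ cong (_* ((n + suc (l + i)) C suc (2 * J))) (*-zeroʳ (Q (suc u) l)) ⟩
        0 ∎
      rowLength : ∀ {l} → l ≤ suc u → suc (J ∸ suc u) ≤ suc J ∸ l
      rowLength {l} l≤u+1 = subst (suc (J ∸ suc u) ≤_) (sym (+-∸-assoc 1 (≤-trans l≤u+1 u<J))) (s≤s (∸-monoʳ-≤ J l≤u+1))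

    -- In Y₁ the index u is the statistic of the leading block.
    Yblock : ℕ → ℕ
    Yblock u = ∑[ m < n ] (P (suc m) (suc u) * TP (n ∸ suc m) (J ∸ suc u))

    Y₁-regroup : Y₁ ≡ ∑[ u < J ] Yblock u
    Y₁-regroup = ∑-swap n J (λ m u → P (suc m) (suc u) * TP (n ∸ suc m) (J ∸ suc u))

    summand : ℕ → ℕ → ℕ → ℕ → ℕ
    summand u l i m = Q (suc u) l * P (J ∸ suc u) i * (((suc m + l) C (2 * suc u)) * (((n ∸ suc m) + i) C (2 * (J ∸ suc u))))

    expand : ∀ u m → transform Q (suc m) (suc u) * TP (n ∸ suc m) (J ∸ suc u)
                       ≡ ∑[ l < suc (suc u) ] ∑[ i < suc (J ∸ suc u) ] summand u l i m
    expand u m = trans (∑-product (suc (suc u)) (suc B) (λ l → Q (suc u) l * ((suc m + l) C (2 * suc u)))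
                                                       (λ i → P B i * (((n ∸ suc m) + i) C (2 * B))))
      (∑-ext (suc (suc u)) (λ l → ∑-ext (suc B) (λ i →
        *-interchange (Q (suc u) l) ((suc m + l) C (2 * suc u)) (P B i) (((n ∸ suc m) + i) C (2 * B)))))
      where
      B : ℕ
      B = J ∸ suc u

    -- Summing over m by Vandermonde's identity, using 2(u+1) + 2(J-u-1) = 2J.
    sum-summand : ∀ u → u < J → ∀ l i → l ≤ suc u → i ≤ J ∸ suc u → ∑[ m < n ] summand u l i m ≡ term u l i
    sum-summand u u<J l i l≤u+1 i≤B = begin
      ∑[ m < n ] summand u l i m
        ≡⟨ ∑-*ˡ n (Q (suc u) l * P B i) (λ m → ((suc m + l) C (2 * suc u)) * (((n ∸ suc m) + i) C (2 * B))) ⟩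
      Q (suc u) l * P B i * ∑[ m < n ] (((suc m + l) C (2 * suc u)) * (((n ∸ suc m) + i) C (2 * B)))
        ≡⟨ cong (Q (suc u) l * P B i *_) (vandermonde-window n l i (2 * suc u) (2 * B) l<2u+2 (≤-trans i≤B (n≤2*n B))) ⟩
      Q (suc u) l * P B i * ((n + suc (l + i)) C suc (2 * suc u + 2 * B))
        ≡⟨ cong (λ x → Q (suc u) l * P B i * ((n + suc (l + i)) C suc x)) 2u+2+2B≡2J ⟩
      term u l i ∎
      where
      open ≡-Reasoning
      B : ℕ
      B = J ∸ suc u
      l<2u+2 : l < 2 * suc u
      l<2u+2 = subst (l <_) (sym (*-suc 2 u)) (s≤s (≤-trans l≤u+1 (s≤s (n≤2*n u))))
      2u+2+2B≡2J : 2 * suc u + 2 * B ≡ 2 * J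
      2u+2+2B≡2J = trans (sym (*-distribˡ-+ 2 (suc u) B)) (cong (2 *_) (m+[n∸m]≡n u<J))

    Yblock≡block : ∀ u → u < J → Yblock u ≡ block u
    Yblock≡block u u<J = begin
      Yblock u
        ≡⟨ ∑-ext n (λ m → cong (_* TP (n ∸ suc m) B) (P≡transform (suc m) (suc u))) ⟩
      ∑[ m < n ] (transform Q (suc m) (suc u) * TP (n ∸ suc m) B)
        ≡⟨ ∑-ext n (expand u) ⟩
      ∑[ m < n ] ∑[ l < suc (suc u) ] ∑[ i < suc B ] summand u l i m
        ≡⟨ ∑-swap n (suc (suc u)) (λ m l → ∑[ i < suc B ] summand u l i m) ⟩
      ∑[ l < suc (suc u) ] ∑[ m < n ] ∑[ i < suc B ] summand u l i m
        ≡⟨ ∑-ext (suc (suc u)) (λ l → ∑-swap n (suc B) (λ m i → summand u l i m)) ⟩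
      ∑[ l < suc (suc u) ] ∑[ i < suc B ] ∑[ m < n ] summand u l i m
        ≡⟨ ∑-cong (suc (suc u)) (λ l l≤u+1 → ∑-cong (suc B) (λ i i≤B →
             sum-summand u u<J l i (≤-pred l≤u+1) (≤-pred i≤B))) ⟩
      block u ∎
      where
      open ≡-Reasoning
      B : ℕ
      B = J ∸ suc u

    Y₁≡X₁ : Y₁ ≡ X₁
    Y₁≡X₁ = begin
      Y₁                   ≡⟨ Y₁-regroup ⟩
      ∑[ u < J ] Yblock u  ≡⟨ ∑-cong J (λ u u<J → trans (Yblock≡block u u<J) (sym (Xblock≡block u u<J))) ⟩
      ∑[ u < J ] Xblock u  ≡⟨ X₁-regroup ⟨
      X₁                   ∎
      where open ≡-Reasoning

    X≡tail : X ≡ stepTail P TP n (suc J)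
    X≡tail = begin
      X        ≡⟨ X-split ⟩
      X₀ + X₁  ≡⟨ cong₂ _+_ Y₀≡X₀ Y₁≡X₁ ⟨
      Y₀ + Y₁  ≡⟨ tail-split ⟨
      stepTail P TP n (suc J) ∎
      where open ≡-Reasoning

  TP-step : ∀ n j → TP (suc n) j ≡ TP n j + stepTail P TP n j
  TP-step n zero = begin
    P 0 0 * ((suc n + 0) C 0) + 0 ≡⟨ cong (λ x → P 0 0 * x + 0) (trans (nC0≡1 (suc n + 0)) (sym (nC0≡1 (n + 0)))) ⟩
    TP n 0                         ≡⟨ +-identityʳ (TP n 0) ⟨
    TP n 0 + 0                     ≡⟨ cong (TP n 0 +_) (∑-zero n (λ _ _ → refl)) ⟨
    TP n 0 + stepTail P TP n 0      ∎
    where open ≡-Reasoning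
  TP-step n (suc J) = begin
    TP (suc n) (suc J)                         ≡⟨ transform-pascal P n J ⟩
    X + TP n (suc J)                           ≡⟨ +-comm X (TP n (suc J)) ⟩
    TP n (suc J) + X                           ≡⟨ cong (TP n (suc J) +_) X≡tail ⟩
    TP n (suc J) + stepTail P TP n (suc J)      ∎
    where
    open ≡-Reasoning
    open Column n J

  transform-solves : Solves P TP
  transform-solves = record
    { initial = TP-initial
    ; step    = λ n j → trans (TP-step n j) (sym (step-split P TP n j)) }

count : {A : Set} → (A → ℕ) → ℕ → List A → ℕ
count f j L = length (filterᵇ (λ x → f x ≡ᵇ j) L)

indicator : Bool → ℕ
indicator true  = 1
indicator false = 0

module _ {A : Set} where

  length-filterᵇ-∷ : ∀ (p : A → Bool) x xs →
    length (filterᵇ p (x ∷ xs)) ≡ indicator (p x) + length (filterᵇ p xs)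
  length-filterᵇ-∷ p x xs with p x
  ... | true  = refl
  ... | false = refl

  filterᵇ-cong : ∀ (p q : A → Bool) xs → (∀ x → x ∈ xs → p x ≡ q x) → filterᵇ p xs ≡ filterᵇ q xs
  filterᵇ-cong p q []       eq = refl
  filterᵇ-cong p q (x ∷ xs) eq with p x | q x | eq x (here refl)
  ... | true  | true  | _ = cong (x ∷_) (filterᵇ-cong p q xs (λ y y∈ → eq y (there y∈)))
  ... | false | false | _ = filterᵇ-cong p q xs (λ y y∈ → eq y (there y∈))

  filterᵇ-∧ : ∀ (p q r : A → Bool) xs →
    filterᵇ (λ x → p x ∧ (q x ∧ r x)) xs ≡ filterᵇ q (filterᵇ (λ x → p x ∧ r x) xs)
  filterᵇ-∧ p q r []       = refl
  filterᵇ-∧ p q r (x ∷ xs) with p x | r x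
  ... | false | _     = filterᵇ-∧ p q r xs
  ... | true  | false rewrite ∧-zeroʳ (q x) = filterᵇ-∧ p q r xs
  ... | true  | true  rewrite ∧-identityʳ (q x) with q x
  ...   | true  = cong (x ∷_) (filterᵇ-∧ p q r xs)
  ...   | false = filterᵇ-∧ p q r xs

  length-filterᵇ-++ : ∀ (p : A → Bool) xs ys →
    length (filterᵇ p (xs ++ ys)) ≡ length (filterᵇ p xs) + length (filterᵇ p ys)
  length-filterᵇ-++ p xs ys = trans (cong length (filter-++ (T? ∘ p) xs ys)) (length-++ (filterᵇ p xs))

  unique-↭ : ∀ {xs ys : List A} → Unique xs → Unique ys → (∀ {z} → z ∈ xs ⇔ z ∈ ys) → xs ↭ ys
  unique-↭ xs! ys! same = ∼bag⇒↭ (unique∧set⇒bag xs! ys! same)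

filterᵇ-map : ∀ {A B : Set} (p : B → Bool) (f : A → B) xs → filterᵇ p (map f xs) ≡ map f (filterᵇ (p ∘ f) xs)
filterᵇ-map p f []       = refl
filterᵇ-map p f (x ∷ xs) with p (f x)
... | true  = cong (f x ∷_) (filterᵇ-map p f xs)
... | false = filterᵇ-map p f xs

module _ {A B : Set} where

  count-↭-map : ∀ (p : B → Bool) (enc : A → B) {L M} → L ↭ map enc M →
    length (filterᵇ p L) ≡ length (filterᵇ (p ∘ enc) M)
  count-↭-map p enc {L} {M} L↭ = begin
    length (filterᵇ p L)                    ≡⟨ ↭-length (filter-↭ (T? ∘ p) L↭) ⟩
    length (filterᵇ p (map enc M))          ≡⟨ cong length (filterᵇ-map p enc M) ⟩
    length (map enc (filterᵇ (p ∘ enc) M))  ≡⟨ length-map enc (filterᵇ (p ∘ enc) M) ⟩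
    length (filterᵇ (p ∘ enc) M)            ∎
    where open ≡-Reasoning

  length-filterᵇ-concatMap : ∀ (p : B → Bool) (f : A → List B) xs →
    length (filterᵇ p (concatMap f xs)) ≡ sum (map (λ x → length (filterᵇ p (f x))) xs)
  length-filterᵇ-concatMap p f []       = refl
  length-filterᵇ-concatMap p f (x ∷ xs) = trans (length-filterᵇ-++ p (f x) (concatMap f xs))
    (cong (length (filterᵇ p (f x)) +_) (length-filterᵇ-concatMap p f xs))

  count-shifted : ∀ (g : B → ℕ) c j L →
    length (filterᵇ (λ b → c + g b ≡ᵇ j) L) ≡ ∑[ j₁ < suc j ] (indicator (c ≡ᵇ j₁) * count g (j ∸ j₁) L)
  count-shifted g zero    j       L = sym (begin
    count g j L + 0 + ∑[ j₁ < j ] 0 ≡⟨ cong (count g j L + 0 +_) (∑-zero j (λ _ _ → refl)) ⟩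
    count g j L + 0 + 0             ≡⟨ trans (+-identityʳ _) (+-identityʳ _) ⟩
    count g j L                     ∎)
    where open ≡-Reasoning
  count-shifted g (suc c) zero    L = cong length (filter-none (T? ∘ (λ b → suc c + g b ≡ᵇ 0)) (All.universal (λ _ ()) L))
  count-shifted g (suc c) (suc j) L = count-shifted g c j L

  count-product : ∀ (f : A → ℕ) (g : B → ℕ) j LA LB →
    length (filterᵇ (λ ab → f (proj₁ ab) + g (proj₂ ab) ≡ᵇ j) (cartesianProduct LA LB))
      ≡ ∑[ j₁ < suc j ] (count f j₁ LA * count g (j ∸ j₁) LB)
  count-product f g j []       LB = sym (∑-zero (suc j) (λ _ _ → refl))
  count-product f g j (x ∷ LA) LB = begin
    length (filterᵇ p (map (x ,_) LB ++ cartesianProduct LA LB))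
      ≡⟨ length-filterᵇ-++ p (map (x ,_) LB) (cartesianProduct LA LB) ⟩
    length (filterᵇ p (map (x ,_) LB)) + length (filterᵇ p (cartesianProduct LA LB))
      ≡⟨ cong₂ _+_ headRow (count-product f g j LA LB) ⟩
    ∑[ j₁ < suc j ] (indicator (f x ≡ᵇ j₁) * count g (j ∸ j₁) LB) + ∑[ j₁ < suc j ] (count f j₁ LA * count g (j ∸ j₁) LB)
      ≡⟨ ∑-+ (suc j) (λ j₁ → indicator (f x ≡ᵇ j₁) * count g (j ∸ j₁) LB) (λ j₁ → count f j₁ LA * count g (j ∸ j₁) LB) ⟨
    ∑[ j₁ < suc j ] (indicator (f x ≡ᵇ j₁) * count g (j ∸ j₁) LB + count f j₁ LA * count g (j ∸ j₁) LB)
      ≡⟨ ∑-ext (suc j) (λ j₁ → trans (sym (*-distribʳ-+ (count g (j ∸ j₁) LB) (indicator (f x ≡ᵇ j₁)) (count f j₁ LA)))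
                                     (cong (_* count g (j ∸ j₁) LB) (sym (length-filterᵇ-∷ (λ y → f y ≡ᵇ j₁) x LA)))) ⟩
    ∑[ j₁ < suc j ] (count f j₁ (x ∷ LA) * count g (j ∸ j₁) LB) ∎
    where
    open ≡-Reasoning
    p : A × B → Bool
    p ab = f (proj₁ ab) + g (proj₂ ab) ≡ᵇ j
    headRow : length (filterᵇ p (map (x ,_) LB)) ≡ ∑[ j₁ < suc j ] (indicator (f x ≡ᵇ j₁) * count g (j ∸ j₁) LB)
    headRow = trans (cong length (filterᵇ-map p (x ,_) LB))
                    (trans (length-map (x ,_) (filterᵇ (p ∘ (x ,_)) LB)) (count-shifted g (f x) j LB))

  map-unique : ∀ (f : A → B) {xs} → (∀ {x y} → x ∈ xs → y ∈ xs → f x ≡ f y → x ≡ y) → Unique xs → Unique (map f xs)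
  map-unique f injective []            = []
  map-unique f injective (x∉xs ∷ xs!)  =
    All.map⁺ (All.tabulate (λ y∈ fx≡fy → All.lookup x∉xs y∈ (injective (here refl) (there y∈) fx≡fy)))
    ∷ map-unique f (λ x∈ y∈ → injective (there x∈) (there y∈)) xs!

  concatMap-unique : ∀ (f : A → List B) (key : B → A) {xs} → Unique xs → (∀ x → Unique (f x)) →
    (∀ x z → z ∈ f x → key z ≡ x) → Unique (concatMap f xs)
  concatMap-unique f key xs! f! keyed =
    UP.concat⁺ (All.map⁺ (All.universal f! _)) (AllPairs.map⁺ (AllPairs.map disjoint xs!))
    where
    disjoint : ∀ {x y} → x ≢ y → Disjoint (f x) (f y)
    disjoint {x} {y} x≢y (z∈fx , z∈fy) = x≢y (trans (sym (keyed x _ z∈fx)) (keyed y _ z∈fy))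

module _ {A : Set} (_≟_ : DecidableEquality A) where
  open import Data.List.Membership.DecPropositional _≟_ using (_∈?_)

  unique-⊆-complete : ∀ {xs ys : List A} → Unique xs → Unique ys → (∀ {z} → z ∈ xs → z ∈ ys) →
    length ys ≤ length xs → ∀ {z} → z ∈ ys → z ∈ xs
  unique-⊆-complete {xs} {ys} xs! ys! xs⊆ys |ys|≤|xs| z∈ys =
    proj₂ (∈-filter⁻ (_∈? xs) {xs = ys} (subst (_ ∈_) (sym nothingDropped) z∈ys))
    where
    inXs↭xs : filter (_∈? xs) ys ↭ xs
    inXs↭xs = unique-↭ (UP.filter⁺ (_∈? xs) ys!) xs!
      (mk⇔ (λ z∈ → proj₂ (∈-filter⁻ (_∈? xs) {xs = ys} z∈)) (λ z∈ → ∈-filter⁺ (_∈? xs) (xs⊆ys z∈) z∈))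
    nothingDropped : filter (_∈? xs) ys ≡ ys
    nothingDropped = filter-complete (_∈? xs) (≤-antisym (length-filter (_∈? xs) ys)
                       (≤-trans |ys|≤|xs| (≤-reflexive (sym (↭-length inXs↭xs)))))

InRange : ℕ → ℕ → Set
InRange m x = 0 < x × x ≤ m

range : ℕ → List ℕ
range m = applyUpTo suc m

∈-range⁺ : ∀ {m x} → InRange m x → x ∈ range m
∈-range⁺ {m} {suc x} (_ , x<m) = ∈-applyUpTo⁺ suc x<m

∈-range⁻ : ∀ {m x} → x ∈ range m → InRange m x
∈-range⁻ x∈ with ∈-applyUpTo⁻ suc x∈
... | _ , i<m , refl = z<s , i<m

range-unique : ∀ m → Unique (range m)
range-unique m = UP.applyUpTo⁺₁ suc m (λ i<j _ i+1≡j+1 → <⇒≢ i<j (suc-injective i+1≡j+1))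

∈-words⁻ : ∀ n m {σ} → σ ∈ words n m → length σ ≡ m × (∀ {x} → x ∈ σ → InRange n x)
∈-words⁻ n zero    (here refl) = refl , λ ()
∈-words⁻ n (suc m) σ∈ with find (∈-concatMap⁻ (λ x → map (x ∷_) (words n m)) {xs = range n} σ∈)
... | x , x∈ , xτ∈ with ∈-map⁻ (x ∷_) xτ∈
... | τ , τ∈ , refl with ∈-words⁻ n m τ∈
... | |τ|≡m , τ-bounded = cong suc |τ|≡m , bounded
  where
  bounded : ∀ {y} → y ∈ x ∷ τ → InRange n y
  bounded (here refl) = ∈-range⁻ x∈
  bounded (there y∈)  = τ-bounded y∈

∈-words⁺ : ∀ n m {σ} → length σ ≡ m → (∀ {x} → x ∈ σ → InRange n x) → σ ∈ words n m
∈-words⁺ n zero    {[]}    refl bounded = here refl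
∈-words⁺ n (suc m) {x ∷ τ} |σ|≡m bounded =
  ∈-concatMap⁺ (λ y → map (y ∷_) (words n m)) {xs = range n}
    (lose (∈-range⁺ (bounded (here refl)))
          (∈-map⁺ (x ∷_) (∈-words⁺ n m (suc-injective |σ|≡m) (bounded ∘ there))))

-- words n m has no repetitions: blocks with different first letters are disjoint.
words-unique : ∀ n m → Unique (words n m)
words-unique n zero    = [] ∷ []
words-unique n (suc m) = concatMap-unique (λ x → map (x ∷_) (words n m)) head (range-unique n)
  (λ x → UP.map⁺ ∷-injectiveʳ (words-unique n m))
  (λ x z z∈ → headOf (∈-map⁻ (x ∷_) z∈))
  where
  head : List ℕ → ℕ
  head []      = 0
  head (x ∷ _) = x
  headOf : ∀ {x z} → ∃ (λ τ → τ ∈ words n m × z ≡ x ∷ τ) → head z ≡ x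
  headOf (_ , _ , refl) = refl

T-not⁻ : ∀ {b} → T (not b) → ¬ T b
T-not⁻ {false} _ ()

T-not⁺ : ∀ {b} → ¬ T b → T (not b)
T-not⁺ {false} _  = _
T-not⁺ {true}  ¬t = ¬t _

any≡⇔∈ : ∀ x xs → T (any (λ y → x ≡ᵇ y) xs) ⇔ x ∈ xs
any≡⇔∈ x xs = mk⇔ (Any.map (≡ᵇ⇒≡ x _) ∘ any⁻ (λ y → x ≡ᵇ y) xs)
                  (any⁺ (λ y → x ≡ᵇ y) ∘ Any.map (≡⇒≡ᵇ x _))

distinct⁻ : ∀ σ → T (distinct σ) → Unique σ
distinct⁻ []      _ = []
distinct⁻ (x ∷ σ) t with Equivalence.to T-∧ t
... | x∉σ , σ! = ¬Any⇒All¬ σ (T-not⁻ x∉σ ∘ Equivalence.from (any≡⇔∈ x σ)) ∷ distinct⁻ σ σ!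

distinct⁺ : ∀ σ → Unique σ → T (distinct σ)
distinct⁺ []      _           = _
distinct⁺ (x ∷ σ) (x∉σ ∷ σ!) = Equivalence.from T-∧
  (T-not⁺ (All¬⇒¬Any x∉σ ∘ Equivalence.to (any≡⇔∈ x σ)) , distinct⁺ σ σ!)

record IsPerm (m : ℕ) (σ : List ℕ) : Set where
  field
    unique  : Unique σ
    bounded : ∀ {x} → x ∈ σ → InRange m x
    onto    : ∀ {x} → InRange m x → x ∈ σ

  -- Two permutations of [m] have the same members, hence the same length.
  same-as-range : ∀ {x} → x ∈ σ ⇔ x ∈ range m
  same-as-range = mk⇔ (∈-range⁺ ∘ bounded) (onto ∘ ∈-range⁻)

  length-perm : length σ ≡ m
  length-perm = trans (↭-length (unique-↭ unique (range-unique m) same-as-range)) (length-applyUpTo suc m)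

∈-perms⁺ : ∀ m {σ} → IsPerm m σ → σ ∈ perms m
∈-perms⁺ m {σ} perm = ∈-filter⁺ (T? ∘ distinct) (∈-words⁺ m m length-perm bounded) (distinct⁺ σ unique)
  where open IsPerm perm

-- By the pigeonhole principle, m distinct values in 1, …, m exhaust them.
∈-perms⁻ : ∀ m {σ} → σ ∈ perms m → IsPerm m σ
∈-perms⁻ m {σ} σ∈ with ∈-filter⁻ (T? ∘ distinct) {xs = words m m} σ∈
... | σ∈words , σ-distinct with ∈-words⁻ m m σ∈words
... | |σ|≡m , σ-bounded = record { unique = σ! ; bounded = σ-bounded ; onto = onto }
  where
  σ! : Unique σ
  σ! = distinct⁻ σ σ-distinct
  onto : ∀ {x} → InRange m x → x ∈ σ
  onto x-in = unique-⊆-complete _≟_ σ! (range-unique m) (∈-range⁺ ∘ σ-bounded)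
    (≤-reflexive (trans (length-applyUpTo suc m) (sym |σ|≡m))) (∈-range⁺ x-in)

perms-unique : ∀ m → Unique (perms m)
perms-unique m = UP.filter⁺ (T? ∘ distinct) (words-unique m m)

¬T⇒≡false : ∀ {b} → ¬ T b → b ≡ false
¬T⇒≡false {false} _  = refl
¬T⇒≡false {true}  ¬t = contradiction _ ¬t

<ᵇ-true : ∀ {x y} → x < y → (x <ᵇ y) ≡ true
<ᵇ-true x<y = Equivalence.to T-≡ (<⇒<ᵇ x<y)

<ᵇ-false : ∀ {x y} → ¬ x < y → (x <ᵇ y) ≡ false
<ᵇ-false {x} {y} x≮y = ¬T⇒≡false (x≮y ∘ <ᵇ⇒< x y)

<ᵇ-true⁻ : ∀ {x y} → (x <ᵇ y) ≡ true → x < y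
<ᵇ-true⁻ {x} {y} eq = <ᵇ⇒< x y (Equivalence.from T-≡ eq)

<ᵇ-false⁻ : ∀ {x y} → (x <ᵇ y) ≡ false → y ≤ x
<ᵇ-false⁻ eq = ≮⇒≥ (λ x<y → true≢false (trans (sym (<ᵇ-true x<y)) eq))
  where
  true≢false : true ≢ false
  true≢false ()

≤ᵇ-true⁻ : ∀ {x y} → (x ≤ᵇ y) ≡ true → x ≤ y
≤ᵇ-true⁻ {x} {y} eq = ≤ᵇ⇒≤ x y (Equivalence.from T-≡ eq)

∧-true⁻ : ∀ {a b} → (a ∧ b) ≡ true → a ≡ true × b ≡ true
∧-true⁻ {true} {true} _ = refl , refl

∨-false⁻ : ∀ {a b} → (a ∨ b) ≡ false → a ≡ false × b ≡ false
∨-false⁻ {false} {false} _ = refl , refl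

any-false⁺ : ∀ (p : ℕ → Bool) zs → (∀ {z} → z ∈ zs → p z ≡ false) → any p zs ≡ false
any-false⁺ p []       _     = refl
any-false⁺ p (z ∷ zs) allFalse rewrite allFalse (here refl) = any-false⁺ p zs (allFalse ∘ there)

any-false⁻ : ∀ (p : ℕ → Bool) zs → any p zs ≡ false → ∀ {z} → z ∈ zs → p z ≡ false
any-false⁻ p (y ∷ zs) eq (here refl) = proj₁ (∨-false⁻ {p y} eq)
any-false⁻ p (y ∷ zs) eq (there z∈)  = any-false⁻ p zs (proj₂ (∨-false⁻ {p y} eq)) z∈

any-++ : ∀ (p : ℕ → Bool) xs ys → any p (xs ++ ys) ≡ (any p xs ∨ any p ys)
any-++ p []       ys = refl
any-++ p (x ∷ xs) ys = trans (cong (p x ∨_) (any-++ p xs ys)) (sym (∨-assoc (p x) _ _))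

Below Above : ℕ → List ℕ → Set
Below v xs = ∀ {x} → x ∈ xs → x < v
Above v xs = ∀ {x} → x ∈ xs → v < x

_≺_ : List ℕ → List ℕ → Set
xs ≺ ys = ∀ {x y} → x ∈ xs → y ∈ ys → x < y

shift : ℕ → List ℕ → List ℕ
shift c = map (c +_)

shift-above : ∀ c β → (∀ {y} → y ∈ β → 0 < y) → Above c (shift c β)
shift-above c β positive y∈ with ∈-map⁻ (c +_) y∈
... | z , z∈ , refl = subst (_< c + z) (+-identityʳ c) (+-monoʳ-< c (positive z∈))

-- has21below x zs tests whether x is the 2 of a 231 whose 3 and 1 lie in zs. This fails
-- when all of zs lies above x,
has21below-above : ∀ x zs → Above x zs → has21below x zs ≡ false
has21below-above x []       _     = refl
has21below-above x (z ∷ zs) above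
  rewrite any-false⁺ (_<ᵇ x) zs (λ y∈ → <ᵇ-false (<-asym (above (there y∈))))
        | ∧-zeroʳ (x <ᵇ z) = has21below-above x zs (above ∘ there)

has21below-++ : ∀ x ys zs → Above x zs → has21below x (ys ++ zs) ≡ has21below x ys
has21below-++ x []       zs above = has21below-above x zs above
has21below-++ x (y ∷ ys) zs above
  rewrite any-++ (_<ᵇ x) ys zs
        | any-false⁺ (_<ᵇ x) zs (λ z∈ → <ᵇ-false (<-asym (above z∈)))
        | ∨-identityʳ (any (_<ᵇ x) ys)
        | has21below-++ x ys zs above = refl

has21below-split : ∀ x ys zs → Below x ys → Above x zs → has21below x (ys ++ zs) ≡ false
has21below-split x []       zs below above = has21below-above x zs above
has21below-split x (y ∷ ys) zs below above
  rewrite <ᵇ-false {x} {y} (<-asym (below (here refl))) = has21below-split x ys zs (below ∘ there) above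

contains231-++ : ∀ xs ys → xs ≺ ys → contains231 (xs ++ ys) ≡ (contains231 xs ∨ contains231 ys)
contains231-++ []       ys _ = refl
contains231-++ (x ∷ xs) ys xs≺ys
  rewrite has21below-++ x xs ys (xs≺ys (here refl))
        | contains231-++ xs ys (xs≺ys ∘ there) = sym (∨-assoc (has21below x xs) _ _)

<ᵇ-shift : ∀ c x y → ((c + x) <ᵇ (c + y)) ≡ (x <ᵇ y)
<ᵇ-shift zero    x y = refl
<ᵇ-shift (suc c) x y = <ᵇ-shift c x y

any-shift : ∀ c x ys → any (_<ᵇ (c + x)) (shift c ys) ≡ any (_<ᵇ x) ys
any-shift c x []       = refl
any-shift c x (y ∷ ys) rewrite <ᵇ-shift c y x | any-shift c x ys = refl

has21below-shift : ∀ c x ys → has21below (c + x) (shift c ys) ≡ has21below x ys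
has21below-shift c x []       = refl
has21below-shift c x (y ∷ ys) rewrite <ᵇ-shift c x y | any-shift c x ys | has21below-shift c x ys = refl

contains231-shift : ∀ c ys → contains231 (shift c ys) ≡ contains231 ys
contains231-shift c []       = refl
contains231-shift c (y ∷ ys) rewrite has21below-shift c y ys | contains231-shift c ys = refl

des-cons : ∀ x y ys → des (x ∷ y ∷ ys) ≡ indicator (y <ᵇ x) + des (y ∷ ys)
des-cons x y ys with y <ᵇ x
... | true  = refl
... | false = refl

des-shift : ∀ c ys → des (shift c ys) ≡ des ys
des-shift c []           = refl
des-shift c (y ∷ [])     = refl
des-shift c (y ∷ z ∷ ys) = begin
  des (c + y ∷ c + z ∷ shift c ys)                              ≡⟨ des-cons (c + y) (c + z) (shift c ys) ⟩
  indicator ((c + z) <ᵇ (c + y)) + des (shift c (z ∷ ys))       ≡⟨ cong₂ _+_ (cong indicator (<ᵇ-shift c z y)) (des-shift c (z ∷ ys)) ⟩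
  indicator (z <ᵇ y) + des (z ∷ ys)                             ≡⟨ des-cons y z ys ⟨
  des (y ∷ z ∷ ys)                                              ∎
  where open ≡-Reasoning

des-++ : ∀ xs ys → xs ≺ ys → des (xs ++ ys) ≡ des xs + des ys
des-++ []           ys _ = refl
des-++ (x ∷ [])     []       _     = refl
des-++ (x ∷ [])     (y ∷ ys) xs≺ys rewrite <ᵇ-false {y} {x} (<-asym (xs≺ys (here refl) (here refl))) = refl
des-++ (x ∷ z ∷ xs) ys       xs≺ys = begin
  des (x ∷ z ∷ xs ++ ys)                            ≡⟨ des-cons x z (xs ++ ys) ⟩
  indicator (z <ᵇ x) + des (z ∷ xs ++ ys)           ≡⟨ cong (indicator (z <ᵇ x) +_) (des-++ (z ∷ xs) ys (xs≺ys ∘ there)) ⟩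
  indicator (z <ᵇ x) + (des (z ∷ xs) + des ys)      ≡⟨ +-assoc (indicator (z <ᵇ x)) (des (z ∷ xs)) (des ys) ⟨
  indicator (z <ᵇ x) + des (z ∷ xs) + des ys        ≡⟨ cong (_+ des ys) (des-cons x z xs) ⟨
  des (x ∷ z ∷ xs) + des ys                         ∎
  where open ≡-Reasoning

-- Descents of v ∷ α when α lies below v: one at the start (if α is nonempty) plus those of α.
leadDes : List ℕ → ℕ
leadDes []       = 0
leadDes (x ∷ xs) = suc (des (x ∷ xs))

des-lead : ∀ v α γ → Below v α → Above v γ → des (v ∷ (α ++ γ)) ≡ leadDes α + des γ
des-lead v []      []      _     _     = refl
des-lead v []      (y ∷ γ) _     above rewrite <ᵇ-false {y} {v} (<-asym (above (here refl))) = refl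
des-lead v (x ∷ α) γ       below above rewrite <ᵇ-true {x} {v} (below (here refl)) =
  cong suc (des-++ (x ∷ α) γ (λ x∈ y∈ → <-trans (below x∈) (above y∈)))

dispOK-++ : ∀ k i xs ys → dispOK k i (xs ++ ys) ≡ (dispOK k i xs ∧ dispOK k (i + length xs) ys)
dispOK-++ k i []       ys rewrite +-identityʳ i = refl
dispOK-++ k i (x ∷ xs) ys rewrite dispOK-++ k (suc i) xs ys | +-suc i (length xs) = sym (∧-assoc ((i ∸ x) ≤ᵇ k) _ _)

dispOK-shift : ∀ k c i ys → dispOK k (c + i) (shift c ys) ≡ dispOK k i ys
dispOK-shift k c i []       = refl
dispOK-shift k c i (y ∷ ys) rewrite [m+n]∸[m+o]≡n∸o c i y | sym (+-suc c i) | dispOK-shift k c (suc i) ys = refl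

dispOK-suc : ∀ k i xs → dispOK (suc k) (suc i) xs ≡ dispOK k i xs
dispOK-suc k i []       = refl
dispOK-suc k i (x ∷ xs) rewrite dispOK-suc k (suc i) xs = cong (_∧ dispOK k (suc i) xs) (firstEntry x)
  where
  <ᵇ-suc : ∀ i k → (i <ᵇ suc k) ≡ (i ≤ᵇ k)
  <ᵇ-suc zero    k = refl
  <ᵇ-suc (suc i) k = refl
  ≤ᵇ-pred : ∀ y k → (y ≤ᵇ suc k) ≡ (pred y ≤ᵇ k)
  ≤ᵇ-pred zero    k = refl
  ≤ᵇ-pred (suc y) k = <ᵇ-suc y k
  firstEntry : ∀ x → ((suc i ∸ x) ≤ᵇ suc k) ≡ ((i ∸ x) ≤ᵇ k)
  firstEntry zero    = <ᵇ-suc i k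
  firstEntry (suc x) = trans (≤ᵇ-pred (i ∸ x) k) (cong (_≤ᵇ k) (pred[m∸n]≡m∸[1+n] i x))

dispOK-∈ : ∀ k i xs {x} → x ∈ xs → dispOK k i xs ≡ true → i ∸ x ≤ k
dispOK-∈ k i (y ∷ xs)     (here refl) ok = ≤ᵇ-true⁻ (proj₁ (∧-true⁻ ok))
dispOK-∈ k i (y ∷ xs) {x} (there x∈)  ok =
  ≤-trans (∸-monoˡ-≤ x (n≤1+n i)) (dispOK-∈ k (suc i) xs x∈ (proj₂ (∧-true⁻ {(i ∸ y) ≤ᵇ k} ok)))

-- The permutation of [n+1] starting with v+1, followed by α (on the values 1..v) and then by β
-- shifted to the values v+2, …, n+1.
glue : ℕ → List ℕ → List ℕ → List ℕ
glue v α β = suc v ∷ (α ++ shift (suc v) β)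

perm-below : ∀ {v α} → IsPerm v α → Below (suc v) α
perm-below α-perm = s≤s ∘ proj₂ ∘ IsPerm.bounded α-perm

perm-positive : ∀ {m β} → IsPerm m β → ∀ {y} → y ∈ β → 0 < y
perm-positive β-perm = proj₁ ∘ IsPerm.bounded β-perm

glue-perm : ∀ {n v α β} → v ≤ n → IsPerm v α → IsPerm (n ∸ v) β → IsPerm (suc n) (glue v α β)
glue-perm {n} {v} {α} {β} v≤n α-perm β-perm = record { unique = unique ; bounded = bounded ; onto = onto }
  where
  module α = IsPerm α-perm
  module β = IsPerm β-perm
  w : ℕ
  w = suc v
  γ : List ℕ
  γ = shift w β
  α-below : Below w α
  α-below = perm-below α-perm
  γ-above : Above w γ
  γ-above = shift-above w β (perm-positive β-perm)
  w∉ : ∀ {y} → y ∈ α ++ γ → w ≢ y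
  w∉ y∈ refl with ∈-++⁻ α y∈
  ... | inj₁ y∈α = <-irrefl refl (α-below y∈α)
  ... | inj₂ y∈γ = <-irrefl refl (γ-above y∈γ)
  unique : Unique (w ∷ (α ++ γ))
  unique = All.tabulate w∉ ∷ UP.++⁺ α.unique (UP.map⁺ (+-cancelˡ-≡ w _ _) β.unique)
                                  (λ (y∈α , y∈γ) → <-asym (α-below y∈α) (γ-above y∈γ))
  bounded : ∀ {y} → y ∈ w ∷ (α ++ γ) → InRange (suc n) y
  bounded (here refl) = z<s , s≤s v≤n
  bounded (there y∈) with ∈-++⁻ α y∈
  ... | inj₁ y∈α = proj₁ (α.bounded y∈α) , ≤-trans (proj₂ (α.bounded y∈α)) (m≤n⇒m≤1+n v≤n)
  ... | inj₂ y∈γ with ∈-map⁻ (w +_) y∈γ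
  ...   | z , z∈β , refl = z<s , subst (w + z ≤_) (cong suc (m+[n∸m]≡n v≤n)) (+-monoʳ-≤ w (proj₂ (β.bounded z∈β)))
  onto : ∀ {x} → InRange (suc n) x → x ∈ w ∷ (α ++ γ)
  onto {x} (0<x , x≤n+1) with <-cmp x w
  ... | tri< x<w _ _ = there (∈-++⁺ˡ (α.onto (0<x , ≤-pred x<w)))
  ... | tri≈ _ refl _ = here refl
  ... | tri> _ _ w<x = there (∈-++⁺ʳ α (subst (_∈ γ) (m+[n∸m]≡n (<⇒≤ w<x))
                         (∈-map⁺ (w +_) (β.onto (m<n⇒0<n∸m w<x , ∸-monoˡ-≤ w x≤n+1)))))

contains231-glue : ∀ v α β → Below (suc v) α → (∀ {y} → y ∈ β → 0 < y) →
  contains231 (glue v α β) ≡ (contains231 α ∨ contains231 β)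
contains231-glue v α β below positive
  rewrite has21below-split (suc v) α (shift (suc v) β) below (shift-above (suc v) β positive)
        | contains231-++ α (shift (suc v) β) (λ x∈ y∈ → <-trans (below x∈) (shift-above (suc v) β positive y∈))
        | contains231-shift (suc v) β = refl

des-glue : ∀ v α β → Below (suc v) α → (∀ {y} → y ∈ β → 0 < y) → des (glue v α β) ≡ leadDes α + des β
des-glue v α β below positive =
  trans (des-lead (suc v) α (shift (suc v) β) below (shift-above (suc v) β positive))
        (cong (leadDes α +_) (des-shift (suc v) β))

-- The first entry has no displacement; α starts at position 2 and β at position v + 2.
dispOK-glue : ∀ k v α β → length α ≡ v → dispOK k 1 (glue v α β) ≡ (dispOK k 2 α ∧ dispOK k 1 β)
dispOK-glue k v α β |α|≡v rewrite 0∸n≡0 v | dispOK-++ k 2 α (shift (suc v) β) | |α|≡v =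
  cong (dispOK k 2 α ∧_) (trans (cong (λ i → dispOK k i (shift (suc v) β)) (cong suc (+-comm 1 v)))
                                (dispOK-shift k (suc v) 1 β))

unique-++ˡ : ∀ xs {ys : List ℕ} → Unique (xs ++ ys) → Unique xs
unique-++ˡ []       _            = []
unique-++ˡ (x ∷ xs) (x∉ ∷ xs++ys!) = All.tabulate (All.lookup x∉ ∘ ∈-++⁺ˡ) ∷ unique-++ˡ xs xs++ys!

unique-++ʳ : ∀ xs {ys : List ℕ} → Unique (xs ++ ys) → Unique ys
unique-++ʳ []       ys!          = ys!
unique-++ʳ (x ∷ xs) (_ ∷ xs++ys!) = unique-++ʳ xs xs++ys!

split-at : ∀ x ys → x ∉ ys → has21below x ys ≡ false → ∃₂ λ α γ → ys ≡ α ++ γ × Below x α × Above x γ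
split-at x []       _   _  = [] , [] , refl , (λ ()) , (λ ())
split-at x (y ∷ ys) x∉ no21 with y <ᵇ x in y<ᵇx
... | true with split-at x ys (x∉ ∘ there) (proj₂ (∨-false⁻ {(x <ᵇ y) ∧ any (_<ᵇ x) ys} no21))
...   | α , γ , refl , below , above = y ∷ α , γ , refl , below′ , above
  where
  below′ : Below x (y ∷ α)
  below′ (here refl) = <ᵇ-true⁻ y<ᵇx
  below′ (there z∈)  = below z∈
split-at x (y ∷ ys) x∉ no21 | false = [] , y ∷ ys , refl , (λ ()) , above
  where
  x<y : x < y
  x<y = ≤∧≢⇒< (<ᵇ-false⁻ y<ᵇx) (x∉ ∘ here)
  nothingBelow : any (_<ᵇ x) ys ≡ false
  nothingBelow = trans (cong (_∧ any (_<ᵇ x) ys) (sym (<ᵇ-true x<y)))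
                       (proj₁ (∨-false⁻ {(x <ᵇ y) ∧ any (_<ᵇ x) ys} no21))
  above : Above x (y ∷ ys)
  above (here refl) = x<y
  above (there z∈)  = ≤∧≢⇒< (<ᵇ-false⁻ (any-false⁻ (_<ᵇ x) ys nothingBelow z∈)) (λ x≡z → x∉ (there (subst (_∈ ys) (sym x≡z) z∈)))

module Blocks {n v : ℕ} {α γ : List ℕ} (σ-perm : IsPerm (suc n) (suc v ∷ (α ++ γ)))
               (below : Below (suc v) α) (above : Above (suc v) γ) where
  private
    module σ = IsPerm σ-perm
    w : ℕ
    w = suc v
    rest! : Unique (α ++ γ)
    rest! with σ.unique
    ... | _ ∷ rest! = rest!
    w<w+ : ∀ {z} → 0 < z → w < w + z
    w<w+ {z} 0<z = subst (_< w + z) (+-identityʳ w) (+-monoʳ-< w 0<z)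

  v≤n : v ≤ n
  v≤n = ≤-pred (proj₂ (σ.bounded (here refl)))

  α-perm : IsPerm v α
  α-perm = record { unique = unique-++ˡ α rest! ; bounded = bounded ; onto = onto }
    where
    bounded : ∀ {y} → y ∈ α → InRange v y
    bounded y∈ = proj₁ (σ.bounded (there (∈-++⁺ˡ y∈))) , ≤-pred (below y∈)
    onto : ∀ {x} → InRange v x → x ∈ α
    onto {x} (0<x , x≤v) with σ.onto (0<x , ≤-trans x≤v (m≤n⇒m≤1+n v≤n))
    ... | here refl = ⊥-elim (<-irrefl refl (s≤s x≤v))
    ... | there x∈ with ∈-++⁻ α x∈
    ...   | inj₁ x∈α = x∈α
    ...   | inj₂ x∈γ = ⊥-elim (<-asym (above x∈γ) (s≤s x≤v))

  β : List ℕ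
  β = map (_∸ w) γ

  unshift : shift w β ≡ γ
  unshift = trans (sym (map-∘ γ)) (map-id-local (All.tabulate (λ y∈ → m+[n∸m]≡n (<⇒≤ (above y∈)))))

  β-perm : IsPerm (n ∸ v) β
  β-perm = record { unique = map-unique (_∸ w) injective (unique-++ʳ α rest!) ; bounded = bounded ; onto = onto }
    where
    injective : ∀ {x y} → x ∈ γ → y ∈ γ → x ∸ w ≡ y ∸ w → x ≡ y
    injective x∈ y∈ eq = trans (sym (m+[n∸m]≡n (<⇒≤ (above x∈)))) (trans (cong (w +_) eq) (m+[n∸m]≡n (<⇒≤ (above y∈))))
    bounded : ∀ {z} → z ∈ β → InRange (n ∸ v) z
    bounded z∈ with ∈-map⁻ (_∸ w) z∈
    ... | y , y∈ , refl = m<n⇒0<n∸m (above y∈) , ∸-monoˡ-≤ w (proj₂ (σ.bounded (there (∈-++⁺ʳ α y∈))))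
    onto : ∀ {z} → InRange (n ∸ v) z → z ∈ β
    onto {z} (0<z , z≤n-v) with σ.onto (z<s , subst (w + z ≤_) (cong suc (m+[n∸m]≡n v≤n)) (+-monoʳ-≤ w z≤n-v))
    ... | here w+z≡w = ⊥-elim (<-irrefl (sym w+z≡w) (w<w+ 0<z))
    ... | there x∈ with ∈-++⁻ α x∈
    ...   | inj₁ w+z∈α = ⊥-elim (<-asym (below w+z∈α) (w<w+ 0<z))
    ...   | inj₂ w+z∈γ = subst (_∈ β) (m+n∸m≡n w z) (∈-map⁺ (_∸ w) w+z∈γ)

record Decomposition (n : ℕ) (σ : List ℕ) : Set where
  field
    v      : ℕ
    α β    : List ℕ
    σ≡glue : σ ≡ glue v α β
    v≤n    : v ≤ n
    α-perm : IsPerm v α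
    β-perm : IsPerm (n ∸ v) β

-- Split at the first entry v+1; the rest is below-then-above because v+1 is not the 2 of a 231.
decompose : ∀ n {σ} → IsPerm (suc n) σ → contains231 σ ≡ false → Decomposition n σ
decompose n {[]} σ-perm _ = ⊥-elim (0≢1+n (IsPerm.length-perm σ-perm))
decompose n {zero ∷ τ} σ-perm _ = ⊥-elim (<-irrefl refl (proj₁ (IsPerm.bounded σ-perm (here refl))))
decompose n {suc v ∷ τ} σ-perm avoids
  with split-at (suc v) τ (Unique[x∷xs]⇒x∉xs (IsPerm.unique σ-perm)) (proj₁ (∨-false⁻ {has21below (suc v) τ} avoids))
... | α , γ , refl , below , above = record
  { v = v ; α = α ; β = β ; σ≡glue = cong (λ γ′ → suc v ∷ (α ++ γ′)) (sym unshift)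
  ; v≤n = v≤n ; α-perm = α-perm ; β-perm = β-perm }
  where open Blocks σ-perm below above

record Good (k i m : ℕ) (σ : List ℕ) : Set where
  field
    perm   : IsPerm m σ
    avoids : contains231 σ ≡ false
    near   : dispOK k i σ ≡ true

good : ℕ → List ℕ → Bool
good k σ = not (contains231 σ) ∧ maxDispLe k σ

admissibles : ℕ → ℕ → List (List ℕ)
admissibles k m = filterᵇ (good k) (perms m)

∈-admissibles⁻ : ∀ {k m σ} → σ ∈ admissibles k m → Good k 1 m σ
∈-admissibles⁻ {k} {m} {σ} σ∈ with ∈-filter⁻ (T? ∘ good k) {xs = perms m} σ∈
... | σ∈perms , σ-good with Equivalence.to T-∧ σ-good
...   | avoids , near = record { perm   = ∈-perms⁻ m σ∈perms
                               ; avoids = Equivalence.to T-not-≡ avoids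
                               ; near   = Equivalence.to T-≡ near }

∈-admissibles⁺ : ∀ {k m σ} → Good k 1 m σ → σ ∈ admissibles k m
∈-admissibles⁺ {k} {m} σ-good = ∈-filter⁺ (T? ∘ good k) (∈-perms⁺ m perm)
  (Equivalence.from T-∧ (Equivalence.from T-not-≡ avoids , Equivalence.from T-≡ near))
  where open Good σ-good

admissibles-unique : ∀ k m → Unique (admissibles k m)
admissibles-unique k m = UP.filter⁺ (T? ∘ good k) (perms-unique m)

-- The blocks α that can follow a first entry v + 1; they occupy positions 2, …, v + 1.
-- For k = 0 only the empty block qualifies, since the entry 1 of α would be displaced.
leadBlocks : ℕ → ℕ → List (List ℕ)
leadBlocks (suc k) v       = admissibles k v
leadBlocks zero    zero    = [] ∷ []
leadBlocks zero    (suc v) = []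

∈-leadBlocks⁻ : ∀ {k v α} → α ∈ leadBlocks k v → Good k 2 v α
∈-leadBlocks⁻ {suc k} {v} {α} α∈ = record { perm = perm ; avoids = avoids ; near = trans (dispOK-suc k 1 α) near }
  where open Good (∈-admissibles⁻ {k} {v} α∈)
∈-leadBlocks⁻ {zero} {zero} (here refl) = record { perm = empty-perm ; avoids = refl ; near = refl }
  where
  empty-perm : IsPerm 0 []
  empty-perm = record { unique = [] ; bounded = λ () ; onto = λ (0<x , x≤0) → ⊥-elim (<-irrefl refl (<-≤-trans 0<x x≤0)) }

∈-leadBlocks⁺ : ∀ {k v α} → Good k 2 v α → α ∈ leadBlocks k v
∈-leadBlocks⁺ {suc k} {v} {α} α-good =
  ∈-admissibles⁺ (record { perm = perm ; avoids = avoids ; near = trans (sym (dispOK-suc k 1 α)) near })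
  where open Good α-good
∈-leadBlocks⁺ {zero} {zero} {α} α-good with IsPerm.length-perm (Good.perm α-good)
∈-leadBlocks⁺ {zero} {zero} {[]} α-good | refl = here refl
∈-leadBlocks⁺ {zero} {suc v} {α} α-good = ⊥-elim (1≰0 (dispOK-∈ 0 2 α (onto (z<s , s≤s z≤n)) near))
  where
  open Good α-good
  open IsPerm perm
  1≰0 : ¬ 1 ≤ 0
  1≰0 ()

leadBlocks-unique : ∀ k v → Unique (leadBlocks k v)
leadBlocks-unique (suc k) v       = admissibles-unique k v
leadBlocks-unique zero    zero    = [] ∷ []
leadBlocks-unique zero    (suc v) = []

Code : Set
Code = ℕ × List ℕ × List ℕ

glueCode : Code → List ℕ
glueCode (v , α , β) = glue v α β

codesWithLead : ℕ → ℕ → ℕ → List Code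
codesWithLead k n v = map (v ,_) (cartesianProduct (leadBlocks k v) (admissibles k (n ∸ v)))

codes : ℕ → ℕ → List Code
codes k n = concatMap (codesWithLead k n) (upTo (suc n))

∈-codes⁻ : ∀ k n {v α β} → (v , α , β) ∈ codes k n → v ≤ n × α ∈ leadBlocks k v × β ∈ admissibles k (n ∸ v)
∈-codes⁻ k n c∈ with find (∈-concatMap⁻ (codesWithLead k n) {xs = upTo (suc n)} c∈)
... | v , v∈ , c∈block with ∈-map⁻ (v ,_) c∈block
...   | _ , αβ∈ , refl = ≤-pred (∈-upTo⁻ v∈) , ∈-cartesianProduct⁻ (leadBlocks k v) (admissibles k (n ∸ v)) αβ∈

∈-codes⁺ : ∀ {k n v α β} → v ≤ n → α ∈ leadBlocks k v → β ∈ admissibles k (n ∸ v) → (v , α , β) ∈ codes k n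
∈-codes⁺ {k} {n} {v} v≤n α∈ β∈ = ∈-concatMap⁺ (codesWithLead k n) {xs = upTo (suc n)}
  (lose (∈-upTo⁺ (s≤s v≤n)) (∈-map⁺ (v ,_) (∈-cartesianProduct⁺ α∈ β∈)))

-- Codes are listed without repetitions, since the blocks for different v are disjoint.
codes-unique : ∀ k n → Unique (codes k n)
codes-unique k n = concatMap-unique (codesWithLead k n) proj₁ (UP.upTo⁺ (suc n))
  (λ v → UP.map⁺ (λ { refl → refl }) (UP.cartesianProduct⁺ (leadBlocks-unique k v) (admissibles-unique k (n ∸ v))))
  (λ v c c∈ → leadOf (∈-map⁻ (v ,_) c∈))
  where
  leadOf : ∀ {v c} {L : List (List ℕ × List ℕ)} → ∃ (λ αβ → αβ ∈ L × c ≡ (v , αβ)) → proj₁ c ≡ v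
  leadOf (_ , _ , refl) = refl

glue-good : ∀ k n c → c ∈ codes k n → glueCode c ∈ admissibles k (suc n)
glue-good k n (v , α , β) c∈ with ∈-codes⁻ k n c∈
... | v≤n , α∈ , β∈ = ∈-admissibles⁺ (record
  { perm   = glue-perm v≤n α.perm β.perm
  ; avoids = trans (contains231-glue v α β (perm-below α.perm) (perm-positive β.perm)) (cong₂ _∨_ α.avoids β.avoids)
  ; near   = trans (dispOK-glue k v α β (IsPerm.length-perm α.perm)) (cong₂ _∧_ α.near β.near) })
  where
  module α = Good {k} (∈-leadBlocks⁻ {k} {v} α∈)
  module β = Good (∈-admissibles⁻ {k} {n ∸ v} β∈)

glue-onto : ∀ k n {σ} → σ ∈ admissibles k (suc n) → ∃ λ c → c ∈ codes k n × glueCode c ≡ σ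
glue-onto k n σ∈ with ∈-admissibles⁻ {k} {suc n} σ∈
... | record { perm = σ-perm ; avoids = σ-avoids ; near = σ-near } with decompose n σ-perm σ-avoids
...   | record { v = v ; α = α ; β = β ; σ≡glue = refl ; v≤n = v≤n ; α-perm = α-perm ; β-perm = β-perm } =
  (v , α , β) , ∈-codes⁺ v≤n (∈-leadBlocks⁺ α-good) (∈-admissibles⁺ β-good) , refl
  where
  avoids : contains231 α ≡ false × contains231 β ≡ false
  avoids = ∨-false⁻ (trans (sym (contains231-glue v α β (perm-below α-perm) (perm-positive β-perm))) σ-avoids)
  near : dispOK k 2 α ≡ true × dispOK k 1 β ≡ true
  near = ∧-true⁻ (trans (sym (dispOK-glue k v α β (IsPerm.length-perm α-perm))) σ-near)
  α-good : Good k 2 v α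
  α-good = record { perm = α-perm ; avoids = proj₁ avoids ; near = proj₁ near }
  β-good : Good k 1 (n ∸ v) β
  β-good = record { perm = β-perm ; avoids = proj₂ avoids ; near = proj₂ near }

++-injective : ∀ (xs xs′ : List ℕ) {ys ys′} → length xs ≡ length xs′ → xs ++ ys ≡ xs′ ++ ys′ → xs ≡ xs′ × ys ≡ ys′
++-injective []       []         _   eq = refl , eq
++-injective (x ∷ xs) (x′ ∷ xs′) len eq with ∷-injective eq
... | refl , eq′ with ++-injective xs xs′ (suc-injective len) eq′
...   | refl , refl = refl , refl

code-length : ∀ k n {v α β} → (v , α , β) ∈ codes k n → length α ≡ v
code-length k n {v} c∈ = IsPerm.length-perm (Good.perm (∈-leadBlocks⁻ {k} {v} (proj₁ (proj₂ (∈-codes⁻ k n c∈)))))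

-- Gluing is injective on codes: v is the first entry and α has length v.
glue-injective : ∀ k n {c c′} → c ∈ codes k n → c′ ∈ codes k n → glueCode c ≡ glueCode c′ → c ≡ c′
glue-injective k n {v , α , β} {v′ , α′ , β′} c∈ c′∈ eq with ∷-injective eq
... | v+1≡v′+1 , rest with suc-injective v+1≡v′+1
...   | refl with ++-injective α α′ (trans (code-length k n c∈) (sym (code-length k n c′∈))) rest
...     | refl , shifted = cong (λ β″ → v , α , β″) (map-injective (+-cancelˡ-≡ (suc v) _ _) shifted)

admissibles↭codes : ∀ k n → admissibles k (suc n) ↭ map glueCode (codes k n)
admissibles↭codes k n = unique-↭ (admissibles-unique k (suc n))
  (map-unique glueCode (glue-injective k n) (codes-unique k n)) (mk⇔ to from)
  where
  to : ∀ {σ} → σ ∈ admissibles k (suc n) → σ ∈ map glueCode (codes k n)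
  to σ∈ with glue-onto k n σ∈
  ... | c , c∈ , refl = ∈-map⁺ glueCode c∈
  from : ∀ {σ} → σ ∈ map glueCode (codes k n) → σ ∈ admissibles k (suc n)
  from σ∈ with ∈-map⁻ glueCode σ∈
  ... | c , c∈ , refl = glue-good k n c c∈

δ : Family
δ m j = δ₀ m * δ₀ j

-- The kernel of the recurrence satisfied by a k: leading blocks are counted by a (k - 1).
kernel : ℕ → Family
kernel zero    = δ
kernel (suc k) = a k

a≡count : ∀ k m j → a k m j ≡ count des j (admissibles k m)
a≡count k m j = cong length (filterᵇ-∧ (not ∘ contains231) (λ σ → des σ ≡ᵇ j) (maxDispLe k) (perms m))

leadDes-admissible : ∀ k v {α} → α ∈ admissibles k (suc v) → leadDes α ≡ suc (des α)
leadDes-admissible k v {α} α∈ = nonempty α (IsPerm.length-perm (Good.perm (∈-admissibles⁻ {k} {suc v} α∈)))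
  where
  nonempty : ∀ α → length α ≡ suc v → leadDes α ≡ suc (des α)
  nonempty (_ ∷ _) _ = refl

count-leadBlocks : ∀ k v j₁ → count leadDes j₁ (leadBlocks k v) ≡ lead (kernel k) v j₁
count-leadBlocks zero    zero    zero     = refl
count-leadBlocks zero    zero    (suc j₁) = refl
count-leadBlocks zero    (suc v) zero     = refl
count-leadBlocks zero    (suc v) (suc j₁) = refl
count-leadBlocks (suc k) zero    zero     = refl
count-leadBlocks (suc k) zero    (suc j₁) = refl
count-leadBlocks (suc k) (suc v) zero     =
  cong length (filter-none (T? ∘ (λ α → leadDes α ≡ᵇ 0))
    (All.tabulate (λ {α} α∈ → subst (λ d → T (d ≡ᵇ 0)) (leadDes-admissible k v α∈))))
count-leadBlocks (suc k) (suc v) (suc j₁) =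
  trans (cong length (filterᵇ-cong _ _ (admissibles k (suc v)) (λ α α∈ → cong (_≡ᵇ suc j₁) (leadDes-admissible k v α∈))))
        (sym (a≡count k (suc v) j₁))

count-codesWithLead : ∀ k n j v →
  length (filterᵇ (λ c → des (glueCode c) ≡ᵇ j) (codesWithLead k n v))
    ≡ ∑[ j₁ < suc j ] (lead (kernel k) v j₁ * a k (n ∸ v) (j ∸ j₁))
count-codesWithLead k n j v = begin
  length (filterᵇ p (map (v ,_) AB))
    ≡⟨ cong length (filterᵇ-map p (v ,_) AB) ⟩
  length (map (v ,_) (filterᵇ (p ∘ (v ,_)) AB))
    ≡⟨ length-map (v ,_) (filterᵇ (p ∘ (v ,_)) AB) ⟩
  length (filterᵇ (p ∘ (v ,_)) AB)
    ≡⟨ cong length (filterᵇ-cong _ _ AB desOfGlue) ⟩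
  length (filterᵇ (λ αβ → leadDes (proj₁ αβ) + des (proj₂ αβ) ≡ᵇ j) AB)
    ≡⟨ count-product leadDes des j A B ⟩
  ∑[ j₁ < suc j ] (count leadDes j₁ A * count des (j ∸ j₁) B)
    ≡⟨ ∑-ext (suc j) (λ j₁ → cong₂ _*_ (count-leadBlocks k v j₁) (sym (a≡count k (n ∸ v) (j ∸ j₁)))) ⟩
  ∑[ j₁ < suc j ] (lead (kernel k) v j₁ * a k (n ∸ v) (j ∸ j₁)) ∎
  where
  open ≡-Reasoning
  A B : List (List ℕ)
  A = leadBlocks k v
  B = admissibles k (n ∸ v)
  AB : List (List ℕ × List ℕ)
  AB = cartesianProduct A B
  p : Code → Bool
  p c = des (glueCode c) ≡ᵇ j
  desOfGlue : ∀ αβ → αβ ∈ AB → p (v , αβ) ≡ (leadDes (proj₁ αβ) + des (proj₂ αβ) ≡ᵇ j)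
  desOfGlue (α , β) αβ∈ with ∈-cartesianProduct⁻ A B αβ∈
  ... | α∈ , β∈ = cong (_≡ᵇ j) (des-glue v α β (perm-below (Good.perm (∈-leadBlocks⁻ {k} {v} α∈)))
                                               (perm-positive (Good.perm (∈-admissibles⁻ {k} {n ∸ v} β∈))))

-- a k satisfies the recurrence: split the permutations of [n+1] by their first entry.
a-step : ∀ k n j → a k (suc n) j ≡ stepSum (kernel k) (a k) n j
a-step k n j = begin
  a k (suc n) j
    ≡⟨ a≡count k (suc n) j ⟩
  count des j (admissibles k (suc n))
    ≡⟨ count-↭-map (λ σ → des σ ≡ᵇ j) glueCode (admissibles↭codes k n) ⟩
  length (filterᵇ p (codes k n))
    ≡⟨ length-filterᵇ-concatMap p (codesWithLead k n) (upTo (suc n)) ⟩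
  sum (map (λ v → length (filterᵇ p (codesWithLead k n v))) (upTo (suc n)))
    ≡⟨ ∑-upTo (suc n) (λ v → length (filterᵇ p (codesWithLead k n v))) ⟩
  ∑[ v < suc n ] length (filterᵇ p (codesWithLead k n v))
    ≡⟨ ∑-ext (suc n) (count-codesWithLead k n j) ⟩
  stepSum (kernel k) (a k) n j ∎
  where
  open ≡-Reasoning
  p : Code → Bool
  p c = des (glueCode c) ≡ᵇ j

a-solves : ∀ k → Solves (kernel k) (a k)
a-solves k = record { initial = λ { zero → refl ; (suc j) → refl } ; step = a-step k }

transform-δ : ∀ n j → transform δ n j ≡ δ₀ j
transform-δ n zero    = trans (+-identityʳ _) (trans (+-identityʳ _) (nC0≡1 (n + 0)))
transform-δ n (suc J) = ∑-zero (suc (suc J)) (λ _ _ → refl)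

stepSum-δ : ∀ F n j → stepSum δ F n j ≡ F n j
stepSum-δ F n j = trans (step-split δ F n j)
  (trans (cong (F n j +_) (∑-zero n (λ _ _ → ∑-zero j (λ _ _ → refl)))) (+-identityʳ (F n j)))

transform-δ-solves : Solves δ (transform δ)
transform-δ-solves = record
  { initial = transform-δ 0
  ; step    = λ n j → trans (transform-δ (suc n) j)
                        (trans (sym (transform-δ n j)) (sym (stepSum-δ (transform δ) n j))) }

kernel₀₀ : ∀ k → kernel k 0 0 ≡ 1
kernel₀₀ zero    = refl
kernel₀₀ (suc k) = refl

-- Main induction on k: a k is the transform of its own kernel, which makes the kernels triangular.
a-transform : ∀ k n j → a k n j ≡ transform (kernel k) n j
kernel-triangular : ∀ k → Triangular (kernel k)

a-transform zero    = solution-unique (a-solves zero) transform-δ-solves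
a-transform (suc k) = solution-unique (a-solves (suc k)) transform-solves
  where open TransformRecurrence (kernel-triangular k) (kernel₀₀ k) (a-solves k) (a-transform k)

kernel-triangular zero    {zero}  {suc j} _   = refl
kernel-triangular zero    {suc n}         _   = refl
kernel-triangular (suc k)                 n<j = trans (a-transform k _ _) (transform-triangular (kernel k) n<j)

-- The convention a' only matters at size 0, where a already gives δ₀.
a'≡a : ∀ k n j → a' k n j ≡ a k n j
a'≡a k zero    zero    = refl
a'≡a k zero    (suc j) = refl
a'≡a k (suc n) j       = refl

-- Corollary 18.
corollary18 : (k n j : ℕ) → 1 ≤ k → 1 ≤ n →
    a k n j ≡ sum (map (λ i → a' (k ∸ 1) j i * ((n + i) C (2 * j))) (upTo (suc j)))
corollary18 (suc k) n j _ _ = begin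
  a (suc k) n j                                   ≡⟨ a-transform (suc k) n j ⟩
  ∑[ i < suc j ] (a k j i * ((n + i) C (2 * j)))  ≡⟨ ∑-ext (suc j) (λ i → cong (_* ((n + i) C (2 * j))) (sym (a'≡a k j i))) ⟩
  ∑[ i < suc j ] (a' k j i * ((n + i) C (2 * j))) ≡⟨ ∑-upTo (suc j) (λ i → a' k j i * ((n + i) C (2 * j))) ⟨
  sum (map (λ i → a' k j i * ((n + i) C (2 * j))) (upTo (suc j))) ∎
  where open ≡-Reasoning
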